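{- (1) The linear maps $U\colon\mathfrak{h}^0\to\mathfrak{h}^0$ and $V\colon\mathfrak{H}^0\to\mathfrak{H}^0$ are linear isomorphisms, with inverses given by $$U^{ -1}(z_{k_1}\cdots z_{k_n})=\sum_{\substack{2\le r_1\le k_1\\ 1\le r_j\le k_j,\ j\ge2}}(-1)^{\sum_j(k_j-r_j)}\binom{k_1-2}{r_1-2}\prod_{j\ge2}\binom{k_j-1}{r_j-1}\,z_{r_1}\cdots z_{r_n},$$ $$V^{ -1}(z_{k_1}\cdots z_{k_n})=\sum_{\substack{1\le r_1\le k_1\\ 0\le r_j\le k_j,\ j\ge2}}(-1)^{\sum_j(k_j-r_j)}\binom{k_1-1}{r_1-1}\prod_{j\ge2}\binom{k_j}{r_j}\,z_{r_1}\cdots z_{r_n}.$$ (2) On $\mathfrak{h}^0$ one has $\zeta^{\mathrm{OOZ}}=\zeta^{\mathrm{BZ}}\circ U$. (3) On $\mathfrak{H}^0$ one has $\zeta^{\mathrm{OOZ}}=\zeta^{\mathrm{SZ}}\circ V$.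
   Context: Let $\mathfrak{H}=\mathbb{Q}\langle p,y\rangle$, $z_k:=p^ky$ ($k\ge0$), and $\mathfrak{H}^0=\mathbb{Q}\mathbf{1}\oplus p\mathfrak{H}y$, spanned by $\mathbf{1}$ and the words $z_{k_1}\cdots z_{k_n}$ with $k_1\ge1$, $k_j\ge0$ ($j\ge2$). Let $\mathfrak{h}^0\subset\mathfrak{H}^0$ be the span of $\mathbf{1}$ and the words $z_{k_1}\cdots z_{k_n}$ with $k_1\ge2$ and $k_j\ge1$ for $j\ge2$ (the convergent words; identifying $x_0=p$, $x_1=py$, one has $z_k=x_0^{k-1}x_1$). Define $U$ on $\mathfrak{h}^0$ and $V$ on $\mathfrak{H}^0$ linearly by $U(\mathbf{1})=V(\mathbf{1})=\mathbf{1}$ and $U(z_{k_1}\cdots z_{k_n})=\sum_{2\le r_1\le k_1,\ 1\le r_j\le k_j\,(j\ge2)}\binom{k_1-2}{r_1-2}\prod_{j\ge2}\binom{k_j-1}{r_j-1}z_{r_1}\cdots z_{r_n}$, $V(z_{k_1}\cdots z_{k_n})=\sum_{1\le r_1\le k_1,\ 0\le r_j\le k_j\,(j\ge2)}\binom{k_1-1}{r_1-1}\prod_{j\ge2}\binom{k_j}{r_j}z_{r_1}\cdots z_{r_n}$. All $q$-series maps send $\mathbf{1}$ to $1$ and are linear, with values in $\mathbb{Q}[[q]]$: $\zeta^{\mathrm{OOZ}}(z_{k_1}\cdots z_{k_n})=\sum_{m_1>\cdots>m_n>0}\frac{q^{m_1}}{\prod_i(1-q^{m_i})^{k_i}}$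 (on $\mathfrak{H}^0$); $\zeta^{\mathrm{SZ}}(z_{k_1}\cdots z_{k_n})=\sum_{m_1>\cdots>m_n>0}\prod_i\frac{q^{m_ik_i}}{(1-q^{m_i})^{k_i}}$ (on $\mathfrak{H}^0$); $\zeta^{\mathrm{BZ}}(z_{k_1}\cdots z_{k_n})=\sum_{m_1>\cdots>m_n>0}\prod_i\frac{q^{(k_i-1)m_i}}{(1-q^{m_i})^{k_i}}$ (on $\mathfrak{h}^0$, i.e. $k_1\ge2$, $k_j\ge1$). -}

module Defs where

open import Data.Nat as ℕ using (ℕ; zero; suc; _∸_; _≤_)
import Data.Integer as ℤ
open import Data.Nat.Combinatorics using (_C_)
open import Data.Nat.Divisibility using (_∣?_)
open import Data.Rational as ℚ using (ℚ; 0ℚ; 1ℚ; _+_; _*_; -_)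
open import Data.List using (List; []; _∷_; map; concatMap; foldr; upTo)
open import Data.List.Relation.Unary.All using (All)
open import Data.List.Membership.Propositional using (_∈_)
open import Data.List.Properties using (≡-dec)
open import Data.Product using (_×_; _,_)
open import Data.Bool using (if_then_else_)
open import Relation.Nullary.Decidable using (⌊_⌋)
open import Relation.Binary.PropositionalEquality using (_≡_)

-- The word z_{k₁} ⋯ z_{kₙ} is represented by the list k₁ ∷ ⋯ ∷ kₙ ∷ [].
-- The empty list is the unit word 𝟏.
Word : Set
Word = List ℕ

-- membership in the spanning set of 𝔥⁰ (convergent words)
data Conv : Word → Set where
  conv-[] : Conv []
  conv-∷  : ∀ {k ks} → 2 ≤ k → All (1 ≤_) ks → Conv (k ∷ ks)

-- membership in the spanning set of ℌ⁰
data Adm : Word → Set where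
  adm-[] : Adm []
  adm-∷  : ∀ {k ks} → 1 ≤ k → Adm (k ∷ ks)

Comb : Set
Comb = List (ℚ × Word)

Σℚ : List ℚ → ℚ
Σℚ = foldr _+_ 0ℚ

coeff : Comb → Word → ℚ
coeff c w = Σℚ (map (λ { (a , v) → if ⌊ ≡-dec ℕ._≟_ v w ⌋ then a else 0ℚ }) c)

_≈C_ : Comb → Comb → Set
c ≈C d = ∀ w → coeff c w ≡ coeff d w

AllWords : (Word → Set) → Comb → Set
AllWords P c = ∀ {a w} → (a , w) ∈ c → P w

lin : (Word → Comb) → Comb → Comb
lin f = concatMap (λ { (a , v) → map (λ { (b , u) → (a * b , u) }) (f v) })

-- range a..k (empty if k < a)
range : ℕ → ℕ → List ℕ
range a k = map (a ℕ.+_) (upTo (suc k ∸ a))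

ℚC : ℕ → ℕ → ℚ
ℚC n r = ℤ.+ (n C r) ℚ./ 1

sgn : ℕ → ℚ
sgn zero = 1ℚ
sgn (suc n) = - sgn n

cart : List (List (ℚ × ℕ)) → Comb
cart [] = (1ℚ , []) ∷ []
cart (xs ∷ xss) =
  concatMap (λ { (a , r) → map (λ { (b , rs) → (a * b , r ∷ rs) }) (cart xss) }) xs

expand : (ℕ → List (ℚ × ℕ)) → (ℕ → List (ℚ × ℕ)) → Word → Comb
expand f g [] = (1ℚ , []) ∷ []
expand f g (k ∷ ks) = cart (f k ∷ map g ks)

U-first U-rest Ui-first Ui-rest V-first V-rest Vi-first Vi-rest : ℕ → List (ℚ × ℕ)
U-first  k = map (λ r → (ℚC (k ∸ 2) (r ∸ 2) , r)) (range 2 k)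
U-rest   k = map (λ r → (ℚC (k ∸ 1) (r ∸ 1) , r)) (range 1 k)
Ui-first k = map (λ r → (sgn (k ∸ r) * ℚC (k ∸ 2) (r ∸ 2) , r)) (range 2 k)
Ui-rest  k = map (λ r → (sgn (k ∸ r) * ℚC (k ∸ 1) (r ∸ 1) , r)) (range 1 k)
V-first  k = map (λ r → (ℚC (k ∸ 1) (r ∸ 1) , r)) (range 1 k)
V-rest   k = map (λ r → (ℚC k r , r)) (range 0 k)
Vi-first k = map (λ r → (sgn (k ∸ r) * ℚC (k ∸ 1) (r ∸ 1) , r)) (range 1 k)
Vi-rest  k = map (λ r → (sgn (k ∸ r) * ℚC k r , r)) (range 0 k)

U U⁻¹ V V⁻¹ : Word → Comb
U   = expand U-first  U-rest
U⁻¹ = expand Ui-first Ui-rest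
V   = expand V-first  V-rest
V⁻¹ = expand Vi-first Vi-rest

PS : Set
PS = ℕ → ℚ

oneP : PS
oneP zero = 1ℚ
oneP (suc _) = 0ℚ

_⊛_ : PS → PS → PS
(f ⊛ g) N = Σℚ (map (λ i → f i * g (N ∸ i)) (upTo (suc N)))

qpow : ℕ → PS
qpow a N = if ⌊ N ℕ.≟ a ⌋ then 1ℚ else 0ℚ

-- 1/(1 - q^m) = Σ_j q^{m j}, for m ≥ 1
geom : ℕ → PS
geom m N = if ⌊ m ∣? N ⌋ then 1ℚ else 0ℚ

_^P_ : PS → ℕ → PS
f ^P zero = oneP
f ^P suc k = f ⊛ (f ^P k)

decSeqs : ℕ → ℕ → List (List ℕ)
decSeqs zero M = [] ∷ []
decSeqs (suc n) M = concatMap (λ m → map (m ∷_) (decSeqs n (m ∸ 1))) (range 1 M)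

len : Word → ℕ
len [] = 0
len (_ ∷ ks) = suc (len ks)

prodP : List PS → PS
prodP = foldr _⊛_ oneP

zipWith' : (ℕ → ℕ → PS) → List ℕ → List ℕ → List PS
zipWith' f (k ∷ ks) (m ∷ ms) = f k m ∷ zipWith' f ks ms
zipWith' f _ _ = []

sumP : List PS → PS
sumP ps N = Σℚ (map (λ p → p N) ps)

partialOOZ partialSZ partialBZ : Word → ℕ → PS
partialOOZ ks M = sumP (map (λ { [] → oneP
                               ; (m₁ ∷ ms) → qpow m₁ ⊛ prodP (zipWith' (λ k m → geom m ^P k) ks (m₁ ∷ ms)) })
                            (decSeqs (len ks) M))
partialSZ ks M = sumP (map (λ ms → prodP (zipWith' (λ k m → qpow (m ℕ.* k) ⊛ (geom m ^P k)) ks ms))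
                           (decSeqs (len ks) M))
partialBZ ks M = sumP (map (λ ms → prodP (zipWith' (λ k m → qpow ((k ∸ 1) ℕ.* m) ⊛ (geom m ^P k)) ks ms))
                           (decSeqs (len ks) M))

-- Every summand with m₁ > N has
-- q-adic order > N (because of q^{m₁}, q^{m₁k₁} with k₁ ≥ 1, resp.
-- q^{(k₁-1)m₁} with k₁ ≥ 2), so the N-th coefficient of the infinite sum
-- is the N-th coefficient of the partial sum over m₁ ≤ N.
ζOOZ ζSZ ζBZ : Word → PS
ζOOZ [] = oneP
ζOOZ ks@(_ ∷ _) N = partialOOZ ks N N
ζSZ [] = oneP
ζSZ ks@(_ ∷ _) N = partialSZ ks N N
ζBZ [] = oneP
ζBZ ks@(_ ∷ _) N = partialBZ ks N N

linζ : (Word → PS) → Comb → PS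
linζ ζ c N = Σℚ (map (λ { (a , w) → a * ζ w N }) c)

_≈P_ : PS → PS → Set
f ≈P g = ∀ N → f N ≡ g N

module Submission where

-- U, U⁻¹, V, V⁻¹ act letter by letter: on z_{a+K} they are given by the matrices C(K,i) and
-- (−1)^{K−i} C(K,i) (with a = 2 for the first letter of U, a = 1 for its other letters and for
-- the first letter of V, a = 0 for the other letters of V). These lower triangular matrices are
-- mutually inverse (binomial inversion), which gives (1).
-- For (2) and (3) fix the summation variable m of a letter and put g = 1/(1 − q^m), so that
-- g = 1 + q^m g. The binomial theorem gives g^K = Σᵢ C(K,i) (q^m g)^i, and shifting indices
-- shows that the BZ (resp. SZ) factors of the image of z_k under U (resp. V) add up to the OOZ
-- factor q^m g^k of a first letter, resp. g^k of any other letter. Multiplying over the letters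
-- and summing over m₁ > ⋯ > mₙ > 0 gives the identities of q-series.

open import Defs
open import Algebra.Bundles using (CommutativeMonoid)
import Algebra.Properties.CommutativeSemigroup as CommSemigroupProperties
open import Data.Bool using (Bool; true; false; if_then_else_; _∧_)
open import Data.Empty using (⊥-elim)
import Data.Integer as ℤ
import Data.Integer.Properties as ℤP
open import Data.List using (List; []; _∷_; map; concatMap; upTo; applyUpTo; _++_; length)
open import Data.List.Membership.Propositional using (_∈_; find)
open import Data.List.Membership.Propositional.Properties using (∈-map⁻; ∈-concatMap⁻)
open import Data.List.Properties using (≡-dec; length-map)
open import Data.List.Relation.Binary.Pointwise using (Pointwise; []; _∷_; Pointwise-length)
open import Data.List.Relation.Unary.All as All using (All; []; _∷_)
open import Data.List.Relation.Unary.Any using (here; there)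
open import Data.Nat as ℕ using (ℕ; zero; suc; _∸_; _≤_; _<_; z≤n; s≤s)
open import Data.Nat.Combinatorics using (_C_)
import Data.Nat.Combinatorics as ℕC
import Data.Nat.Coprimality as Coprimality
open import Data.Nat.Divisibility using (_∣_; _∣?_; _∣0; ∣m+n∣m⇒∣n; ∣m∣n⇒∣m+n; ∣-refl; ∣⇒≤)
import Data.Nat.Properties as ℕP
open import Data.Product using (_×_; _,_; proj₁; proj₂; ∃-syntax)
open import Data.Rational as ℚ using (ℚ; 0ℚ; 1ℚ; _+_; _*_; -_; mkℚ)
import Data.Rational.Properties as ℚP
open import Data.Rational.Solver using (module +-*-Solver)
open import Data.Sum using (inj₁; inj₂)
open import Function using (_∘_; id)
open import Relation.Binary.PropositionalEquality
open import Relation.Binary.Structures using (IsEquivalence)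
open import Relation.Nullary.Decidable using (Dec; yes; no; does; _because_; ⌊_⌋)
open import Relation.Nullary.Negation using (¬_)

open ≡-Reasoning
open +-*-Solver using (solve; con; _:+_; _:*_; :-_; _:=_)

-- Finite sums

module +-CS = CommSemigroupProperties (CommutativeMonoid.commutativeSemigroup ℚP.+-0-commutativeMonoid)
module *-CS = CommSemigroupProperties (CommutativeMonoid.commutativeSemigroup ℚP.*-1-commutativeMonoid)

∑< : ℕ → (ℕ → ℚ) → ℚ
∑< zero    f = 0ℚ
∑< (suc n) f = f 0 + ∑< n (f ∘ suc)

infix 5 ∑<
syntax ∑< n (λ i → e) = ∑[ i < n ] e

∑ : {A : Set} → List A → (A → ℚ) → ℚ
∑ xs f = Σℚ (map f xs)

infix 5 ∑
syntax ∑ xs (λ x → e) = ∑[ x ∈ xs ] e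

∑<-cong : ∀ n {f g : ℕ → ℚ} → (∀ i → f i ≡ g i) → ∑< n f ≡ ∑< n g
∑<-cong zero    f≗g = refl
∑<-cong (suc n) f≗g = cong₂ _+_ (f≗g 0) (∑<-cong n (f≗g ∘ suc))

∑<-cong-< : ∀ n {f g : ℕ → ℚ} → (∀ i → i < n → f i ≡ g i) → ∑< n f ≡ ∑< n g
∑<-cong-< zero    f≗g = refl
∑<-cong-< (suc n) f≗g = cong₂ _+_ (f≗g 0 (s≤s z≤n)) (∑<-cong-< n (λ i i<n → f≗g (suc i) (s≤s i<n)))

∑<-zero : ∀ n → ∑[ i < n ] 0ℚ ≡ 0ℚ
∑<-zero zero    = refl
∑<-zero (suc n) = trans (ℚP.+-identityˡ _) (∑<-zero n)

∑<-+ : ∀ n (f g : ℕ → ℚ) → ∑[ i < n ] (f i + g i) ≡ ∑< n f + ∑< n g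
∑<-+ zero    f g = sym (ℚP.+-identityˡ 0ℚ)
∑<-+ (suc n) f g = trans (cong ((f 0 + g 0) +_) (∑<-+ n (f ∘ suc) (g ∘ suc)))
                         (+-CS.interchange (f 0) (g 0) _ _)

∑<-*ˡ : ∀ n c (f : ℕ → ℚ) → ∑[ i < n ] (c * f i) ≡ c * ∑< n f
∑<-*ˡ zero    c f = sym (ℚP.*-zeroʳ c)
∑<-*ˡ (suc n) c f = trans (cong (c * f 0 +_) (∑<-*ˡ n c (f ∘ suc))) (sym (ℚP.*-distribˡ-+ c _ _))

∑<-*ʳ : ∀ n c (f : ℕ → ℚ) → ∑[ i < n ] (f i * c) ≡ ∑< n f * c
∑<-*ʳ n c f = trans (∑<-cong n (λ i → ℚP.*-comm (f i) c)) (trans (∑<-*ˡ n c f) (ℚP.*-comm c _))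

∑<-neg : ∀ n (f : ℕ → ℚ) → ∑[ i < n ] (- f i) ≡ - ∑< n f
∑<-neg zero    f = refl
∑<-neg (suc n) f = trans (cong (- f 0 +_) (∑<-neg n (f ∘ suc))) (sym (ℚP.neg-distrib-+ (f 0) _))

∑<-suc-last : ∀ n (f : ℕ → ℚ) → ∑< (suc n) f ≡ ∑< n f + f n
∑<-suc-last zero    f = trans (ℚP.+-identityʳ (f 0)) (sym (ℚP.+-identityˡ (f 0)))
∑<-suc-last (suc n) f = trans (cong (f 0 +_) (∑<-suc-last n (f ∘ suc))) (sym (ℚP.+-assoc (f 0) _ _))

∑<-reverse : ∀ n (f : ℕ → ℚ) → ∑< (suc n) f ≡ ∑[ i < suc n ] f (n ∸ i)
∑<-reverse zero    f = refl
∑<-reverse (suc n) f = begin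
  ∑< (suc (suc n)) f                      ≡⟨ ∑<-suc-last (suc n) f ⟩
  ∑< (suc n) f + f (suc n)                ≡⟨ cong (_+ f (suc n)) (∑<-reverse n f) ⟩
  (∑[ i < suc n ] f (n ∸ i)) + f (suc n) ≡⟨ ℚP.+-comm _ (f (suc n)) ⟩
  f (suc n) + (∑[ i < suc n ] f (n ∸ i)) ∎

∑<-triangle : ∀ n (F : ℕ → ℕ → ℚ) →
  ∑[ i < suc n ] ∑[ j < suc (n ∸ i) ] F i j ≡ ∑[ s < suc n ] ∑[ i < suc s ] F i (s ∸ i)
∑<-triangle zero    F = refl
∑<-triangle (suc n) F = begin
  (F 0 0 + X) + (∑[ i < suc n ] ∑[ j < suc (n ∸ i) ] F (suc i) j)
    ≡⟨ cong ((F 0 0 + X) +_) (∑<-triangle n (F ∘ suc)) ⟩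
  (F 0 0 + X) + Y
    ≡⟨ ℚP.+-assoc (F 0 0) X Y ⟩
  F 0 0 + (X + Y)
    ≡⟨ cong₂ _+_ (sym (ℚP.+-identityʳ (F 0 0))) (sym (∑<-+ (suc n) (λ s → F 0 (suc s)) (λ s → ∑[ i < suc s ] F (suc i) (s ∸ i)))) ⟩
  ∑[ s < suc (suc n) ] ∑[ i < suc s ] F i (s ∸ i) ∎
  where
  X = ∑[ s < suc n ] F 0 (suc s)
  Y = ∑[ s < suc n ] ∑[ i < suc s ] F (suc i) (s ∸ i)

∑-upTo : ∀ n (f : ℕ → ℚ) → ∑ (upTo n) f ≡ ∑< n f
∑-upTo n f = go id n
  where
  go : ∀ (g : ℕ → ℕ) n → ∑ (applyUpTo g n) f ≡ ∑[ i < n ] f (g i)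
  go g zero    = refl
  go g (suc n) = cong (f (g 0) +_) (go (g ∘ suc) n)

∑-cong : ∀ {A : Set} {F G : A → ℚ} xs → (∀ x → F x ≡ G x) → ∑ xs F ≡ ∑ xs G
∑-cong []       F≗G = refl
∑-cong (x ∷ xs) F≗G = cong₂ _+_ (F≗G x) (∑-cong xs F≗G)

∑-cong-∈ : ∀ {A : Set} {F G : A → ℚ} xs → (∀ {x} → x ∈ xs → F x ≡ G x) → ∑ xs F ≡ ∑ xs G
∑-cong-∈ []       F≗G = refl
∑-cong-∈ (x ∷ xs) F≗G = cong₂ _+_ (F≗G (here refl)) (∑-cong-∈ xs (F≗G ∘ there))

∑-zero : ∀ {A : Set} (xs : List A) → ∑[ x ∈ xs ] 0ℚ ≡ 0ℚ
∑-zero []       = refl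
∑-zero (x ∷ xs) = trans (ℚP.+-identityˡ _) (∑-zero xs)

∑-+ : ∀ {A : Set} (F G : A → ℚ) xs → ∑[ x ∈ xs ] (F x + G x) ≡ ∑ xs F + ∑ xs G
∑-+ F G []       = sym (ℚP.+-identityˡ 0ℚ)
∑-+ F G (x ∷ xs) = trans (cong ((F x + G x) +_) (∑-+ F G xs)) (+-CS.interchange (F x) (G x) _ _)

∑-*ˡ : ∀ {A : Set} c (F : A → ℚ) xs → ∑[ x ∈ xs ] (c * F x) ≡ c * ∑ xs F
∑-*ˡ c F []       = sym (ℚP.*-zeroʳ c)
∑-*ˡ c F (x ∷ xs) = trans (cong (c * F x +_) (∑-*ˡ c F xs)) (sym (ℚP.*-distribˡ-+ c _ _))

∑-++ : ∀ {A : Set} (F : A → ℚ) xs ys → ∑ (xs ++ ys) F ≡ ∑ xs F + ∑ ys F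
∑-++ F []       ys = sym (ℚP.+-identityˡ _)
∑-++ F (x ∷ xs) ys = trans (cong (F x +_) (∑-++ F xs ys)) (sym (ℚP.+-assoc (F x) _ _))

∑-map : ∀ {A B : Set} (F : B → ℚ) (g : A → B) xs → ∑ (map g xs) F ≡ ∑ xs (F ∘ g)
∑-map F g []       = refl
∑-map F g (x ∷ xs) = cong (F (g x) +_) (∑-map F g xs)

∑-concatMap : ∀ {A B : Set} (F : B → ℚ) (g : A → List B) xs →
  ∑ (concatMap g xs) F ≡ ∑[ x ∈ xs ] ∑ (g x) F
∑-concatMap F g []       = refl
∑-concatMap F g (x ∷ xs) = trans (∑-++ F (g x) (concatMap g xs)) (cong (∑ (g x) F +_) (∑-concatMap F g xs))

∑-swap : ∀ {A B : Set} (F : A → B → ℚ) xs ys →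
  ∑[ x ∈ xs ] ∑ ys (F x) ≡ ∑[ y ∈ ys ] ∑[ x ∈ xs ] F x y
∑-swap F []       ys = sym (∑-zero ys)
∑-swap F (x ∷ xs) ys = trans (cong (∑ ys (F x) +_) (∑-swap F xs ys)) (sym (∑-+ (F x) _ ys))

∑-range : ∀ (F : ℕ → ℚ) a K → ∑ (range a (a ℕ.+ K)) F ≡ ∑[ i < suc K ] F (a ℕ.+ i)
∑-range F a K = begin
  ∑ (range a (a ℕ.+ K)) F                        ≡⟨ ∑-map F (a ℕ.+_) (upTo (suc (a ℕ.+ K) ∸ a)) ⟩
  ∑ (upTo (suc (a ℕ.+ K) ∸ a)) (F ∘ (a ℕ.+_))   ≡⟨ ∑-upTo (suc (a ℕ.+ K) ∸ a) _ ⟩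
  ∑< (suc (a ℕ.+ K) ∸ a) (F ∘ (a ℕ.+_))         ≡⟨ cong (λ n → ∑< n (F ∘ (a ℕ.+_))) length-eq ⟩
  ∑[ i < suc K ] F (a ℕ.+ i)                     ∎
  where
  length-eq : suc (a ℕ.+ K) ∸ a ≡ suc K
  length-eq = trans (cong (_∸ a) (sym (ℕP.+-suc a K))) (ℕP.m+n∸m≡n a (suc K))

linℚ : {A : Set} → (A → ℚ) → List (ℚ × A) → ℚ
linℚ F c = ∑[ p ∈ c ] proj₁ p * F (proj₂ p)

linℚ-cong : ∀ {A : Set} {F G : A → ℚ} c → (∀ x → F x ≡ G x) → linℚ F c ≡ linℚ G c
linℚ-cong c F≗G = ∑-cong c (λ p → cong (proj₁ p *_) (F≗G (proj₂ p)))

linℚ-cong-∈ : ∀ {A : Set} {F G : A → ℚ} c → (∀ {a v} → (a , v) ∈ c → F v ≡ G v) → linℚ F c ≡ linℚ G c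
linℚ-cong-∈ c F≡G = ∑-cong-∈ c (λ {p} p∈c → cong (proj₁ p *_) (F≡G p∈c))

linℚ-*ˡ : ∀ {A : Set} k (F : A → ℚ) c → linℚ (λ v → k * F v) c ≡ k * linℚ F c
linℚ-*ˡ k F c = trans (∑-cong c (λ p → *-CS.x∙yz≈y∙xz (proj₁ p) k (F (proj₂ p))))
                      (∑-*ˡ k (λ p → proj₁ p * F (proj₂ p)) c)

linℚ-*ʳ : ∀ {A : Set} k (F : A → ℚ) c → linℚ (λ v → F v * k) c ≡ linℚ F c * k
linℚ-*ʳ k F c = trans (linℚ-cong c (λ v → ℚP.*-comm (F v) k)) (trans (linℚ-*ˡ k F c) (ℚP.*-comm k _))

linℚ-zero : ∀ {A : Set} (c : List (ℚ × A)) → linℚ (λ _ → 0ℚ) c ≡ 0ℚ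
linℚ-zero c = trans (∑-cong c (λ p → ℚP.*-zeroʳ (proj₁ p))) (∑-zero c)

linℚ-singleton : ∀ {A : Set} (F : A → ℚ) x → linℚ F ((1ℚ , x) ∷ []) ≡ F x
linℚ-singleton F x = trans (ℚP.+-identityʳ _) (ℚP.*-identityˡ (F x))

linℚ-∑ : ∀ {A B : Set} (F : A → B → ℚ) (ys : List B) c →
  linℚ (λ v → ∑ ys (F v)) c ≡ ∑[ y ∈ ys ] linℚ (λ v → F v y) c
linℚ-∑ F ys c = trans (∑-cong c (λ p → sym (∑-*ˡ (proj₁ p) (F (proj₂ p)) ys)))
                      (∑-swap (λ p y → proj₁ p * F (proj₂ p) y) c ys)

linℚ-lin : ∀ (F : Word → ℚ) f c → linℚ F (lin f c) ≡ linℚ (λ v → linℚ F (f v)) c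
linℚ-lin F f c = trans (∑-concatMap _ _ c) (∑-cong c λ { (a , v) →
  trans (∑-map (λ p → proj₁ p * F (proj₂ p)) _ (f v))
        (trans (∑-cong (f v) (λ { (b , u) → ℚP.*-assoc a b (F u) }))
               (∑-*ˡ a (λ p → proj₁ p * F (proj₂ p)) (f v))) })

linℚ-cart-∷ : ∀ (F : Word → ℚ) xs xss →
  linℚ F (cart (xs ∷ xss)) ≡ linℚ (λ r → linℚ (λ rs → F (r ∷ rs)) (cart xss)) xs
linℚ-cart-∷ F xs xss = trans (∑-concatMap _ _ xs) (∑-cong xs λ { (a , r) →
  trans (∑-map (λ p → proj₁ p * F (proj₂ p)) _ (cart xss))
        (trans (∑-cong (cart xss) (λ { (b , rs) → ℚP.*-assoc a b (F (r ∷ rs)) }))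
               (∑-*ˡ a (λ p → proj₁ p * F (r ∷ proj₂ p)) (cart xss))) })

linℚ-cart-product : ∀ (F : Word → ℚ) (A : ℕ → ℚ) (B : Word → ℚ) xs xss →
  (∀ r rs → F (r ∷ rs) ≡ A r * B rs) → linℚ F (cart (xs ∷ xss)) ≡ linℚ A xs * linℚ B (cart xss)
linℚ-cart-product F A B xs xss F≡A*B = begin
  linℚ F (cart (xs ∷ xss))                                 ≡⟨ linℚ-cart-∷ F xs xss ⟩
  linℚ (λ r → linℚ (λ rs → F (r ∷ rs)) (cart xss)) xs      ≡⟨ linℚ-cong xs (λ r → linℚ-cong (cart xss) (F≡A*B r)) ⟩
  linℚ (λ r → linℚ (λ rs → A r * B rs) (cart xss)) xs      ≡⟨ linℚ-cong xs (λ r → linℚ-*ˡ (A r) B (cart xss)) ⟩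
  linℚ (λ r → A r * linℚ B (cart xss)) xs                  ≡⟨ linℚ-*ʳ (linℚ B (cart xss)) A xs ⟩
  linℚ A xs * linℚ B (cart xss)                            ∎

𝟙 : Bool → ℚ
𝟙 b = if b then 1ℚ else 0ℚ

𝟙-∧ : ∀ b c → 𝟙 (b ∧ c) ≡ 𝟙 b * 𝟙 c
𝟙-∧ true  true  = refl
𝟙-∧ true  false = refl
𝟙-∧ false true  = refl
𝟙-∧ false false = refl

if-then-0 : ∀ a b → (if b then a else 0ℚ) ≡ a * 𝟙 b
if-then-0 a true  = sym (ℚP.*-identityʳ a)
if-then-0 a false = sym (ℚP.*-zeroʳ a)

𝟙-⇔ : ∀ {A B : Set} → (A → B) → (B → A) → (a? : Dec A) (b? : Dec B) → 𝟙 ⌊ a? ⌋ ≡ 𝟙 ⌊ b? ⌋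
𝟙-⇔ A→B B→A (yes _) (yes _) = refl
𝟙-⇔ A→B B→A (yes a) (no ¬b) = ⊥-elim (¬b (A→B a))
𝟙-⇔ A→B B→A (no ¬a) (yes b) = ⊥-elim (¬a (B→A b))
𝟙-⇔ A→B B→A (no _)  (no _)  = refl

𝟙-yes : ∀ {A : Set} → A → (a? : Dec A) → 𝟙 ⌊ a? ⌋ ≡ 1ℚ
𝟙-yes a (yes _) = refl
𝟙-yes a (no ¬a) = ⊥-elim (¬a a)

𝟙-no : ∀ {A : Set} → ¬ A → (a? : Dec A) → 𝟙 ⌊ a? ⌋ ≡ 0ℚ
𝟙-no ¬a (yes a) = ⊥-elim (¬a a)
𝟙-no ¬a (no _)  = refl

isYes≡does : ∀ {A : Set} (d : Dec A) → ⌊ d ⌋ ≡ does d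
isYes≡does (true  because _) = refl
isYes≡does (false because _) = refl

-- δ s r is the coefficient of the letter z_s in z_r.
δ : ℕ → ℕ → ℚ
δ s r = 𝟙 (r ℕ.≡ᵇ s)

δʷ : Word → Word → ℚ
δʷ w v = 𝟙 ⌊ ≡-dec ℕ._≟_ v w ⌋

δ-transport : ∀ (f : ℕ → ℚ) S K → f K * δ S K ≡ f S * δ S K
δ-transport f zero    zero    = refl
δ-transport f zero    (suc K) = trans (ℚP.*-zeroʳ (f (suc K))) (sym (ℚP.*-zeroʳ (f 0)))
δ-transport f (suc S) zero    = trans (ℚP.*-zeroʳ (f 0)) (sym (ℚP.*-zeroʳ (f (suc S))))
δ-transport f (suc S) (suc K) = δ-transport (f ∘ suc) S K

δʷ-∷ : ∀ s ss r rs → δʷ (s ∷ ss) (r ∷ rs) ≡ δ s r * δʷ ss rs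
δʷ-∷ s ss r rs = begin
  𝟙 ⌊ ≡-dec ℕ._≟_ (r ∷ rs) (s ∷ ss) ⌋             ≡⟨ cong 𝟙 (isYes≡does (≡-dec ℕ._≟_ (r ∷ rs) (s ∷ ss))) ⟩
  𝟙 ((r ℕ.≡ᵇ s) ∧ does (≡-dec ℕ._≟_ rs ss))       ≡⟨ 𝟙-∧ (r ℕ.≡ᵇ s) _ ⟩
  δ s r * 𝟙 (does (≡-dec ℕ._≟_ rs ss))           ≡⟨ cong (λ b → δ s r * 𝟙 b) (isYes≡does (≡-dec ℕ._≟_ rs ss)) ⟨
  δ s r * δʷ ss rs                               ∎

coeff≡linℚ-δʷ : ∀ c w → coeff c w ≡ linℚ (δʷ w) c
coeff≡linℚ-δʷ c w = ∑-cong c (λ { (a , v) → if-then-0 a ⌊ ≡-dec ℕ._≟_ v w ⌋ })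

δ-shift : ∀ {a s} i → a ≤ s → δ s (a ℕ.+ i) ≡ δ (s ∸ a) i
δ-shift i z≤n       = refl
δ-shift i (s≤s a≤s) = δ-shift i a≤s

δ-below : ∀ {a s} i → s < a → δ s (a ℕ.+ i) ≡ 0ℚ
δ-below {suc a} {zero}  i _         = refl
δ-below {suc a} {suc s} i (s≤s s<a) = δ-below i s<a

δ-+ : ∀ a s r → δ (a ℕ.+ s) (a ℕ.+ r) ≡ δ s r
δ-+ zero    s r = refl
δ-+ (suc a) s r = δ-+ a s r

δ-< : ∀ {r s} → r < s → δ s r ≡ 0ℚ
δ-< {zero}  {suc s} _         = refl
δ-< {suc r} {suc s} (s≤s r<s) = δ-< r<s

∑-δ : ∀ n (h : ℕ → ℚ) j → (n ≤ j → h j ≡ 0ℚ) → ∑[ i < n ] h i * δ j i ≡ h j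
∑-δ zero    h j h-vanishes = sym (h-vanishes z≤n)
∑-δ (suc n) h zero    _ = begin
  h 0 * 1ℚ + (∑[ i < n ] h (suc i) * 0ℚ)
    ≡⟨ cong₂ _+_ (ℚP.*-identityʳ (h 0)) (trans (∑<-cong n (λ i → ℚP.*-zeroʳ (h (suc i)))) (∑<-zero n)) ⟩
  h 0 + 0ℚ ≡⟨ ℚP.+-identityʳ (h 0) ⟩
  h 0 ∎
∑-δ (suc n) h (suc j) h-vanishes = begin
  h 0 * 0ℚ + (∑[ i < n ] h (suc i) * δ j i)
    ≡⟨ cong₂ _+_ (ℚP.*-zeroʳ (h 0)) (∑-δ n (h ∘ suc) j (h-vanishes ∘ s≤s)) ⟩
  0ℚ + h (suc j) ≡⟨ ℚP.+-identityˡ (h (suc j)) ⟩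
  h (suc j) ∎

∑-δ-beyond : ∀ n (h : ℕ → ℚ) j → n ≤ j → ∑[ i < n ] h i * δ j i ≡ 0ℚ
∑-δ-beyond zero    h j       _         = refl
∑-δ-beyond (suc n) h (suc j) (s≤s n≤j) =
  trans (cong₂ _+_ (ℚP.*-zeroʳ (h 0)) (∑-δ-beyond n (h ∘ suc) j n≤j)) (ℚP.+-identityˡ 0ℚ)

-- Binomial inversion

toℚ : ℕ → ℚ
toℚ n = ℤ.+ n ℚ./ 1

toℚ-+ : ∀ a b → toℚ (a ℕ.+ b) ≡ toℚ a + toℚ b
toℚ-+ a b = sym (begin
  toℚ a + toℚ b
    ≡⟨ cong₂ _+_ (as-mkℚ a) (as-mkℚ b) ⟩
  (ℤ.+ a ℤ.* ℤ.+ 1 ℤ.+ ℤ.+ b ℤ.* ℤ.+ 1) ℚ./ 1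
    ≡⟨ cong₂ (λ x y → (x ℤ.+ y) ℚ./ 1) (ℤP.*-identityʳ (ℤ.+ a)) (ℤP.*-identityʳ (ℤ.+ b)) ⟩
  toℚ (a ℕ.+ b) ∎)
  where
  as-mkℚ : ∀ n → toℚ n ≡ mkℚ (ℤ.+ n) 0 (Coprimality.sym (Coprimality.1-coprimeTo n))
  as-mkℚ n = ℚP.normalize-coprime (Coprimality.sym (Coprimality.1-coprimeTo n))

ℚC-pascal : ∀ K i → ℚC (suc K) (suc i) ≡ ℚC K i + ℚC K (suc i)
ℚC-pascal K i = trans (cong toℚ (sym (ℕC.nCk+nC[k+1]≡[n+1]C[k+1] K i))) (toℚ-+ (K C i) (K C suc i))

K<i⇒ℚC≡0 : ∀ {K i} → K < i → ℚC K i ≡ 0ℚ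
K<i⇒ℚC≡0 K<i = cong toℚ (ℕC.k>n⇒nCk≡0 K<i)

sgn-∸ : ∀ {i K} → i ≤ K → sgn (K ∸ i) ≡ sgn K * sgn i
sgn-∸ {K = K} z≤n       = sym (ℚP.*-identityʳ (sgn K))
sgn-∸ {suc i} {suc K} (s≤s i≤K) =
  trans (sgn-∸ i≤K) (solve 2 (λ x y → x :* y := (:- x) :* (:- y)) refl (sgn K) (sgn i))

sgn² : ∀ n → sgn n * sgn n ≡ 1ℚ
sgn² zero    = refl
sgn² (suc n) = trans (solve 1 (λ x → (:- x) :* (:- x) := x :* x) refl (sgn n)) (sgn² n)

signed-binomial : ∀ K i → sgn (K ∸ i) * ℚC K i ≡ sgn K * (sgn i * ℚC K i)
signed-binomial K i with ℕP.≤-<-connex i K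
... | inj₁ i≤K = trans (cong (_* ℚC K i) (sgn-∸ i≤K)) (ℚP.*-assoc (sgn K) (sgn i) (ℚC K i))
... | inj₂ K<i rewrite K<i⇒ℚC≡0 K<i =
  trans (ℚP.*-zeroʳ (sgn (K ∸ i))) (sym (trans (cong (sgn K *_) (ℚP.*-zeroʳ (sgn i))) (ℚP.*-zeroʳ (sgn K))))

∑-binomial-extend : ∀ K (h : ℕ → ℚ) → ∑[ i < suc (suc K) ] ℚC K i * h i ≡ ∑[ i < suc K ] ℚC K i * h i
∑-binomial-extend K h = begin
  ∑[ i < suc (suc K) ] ℚC K i * h i               ≡⟨ ∑<-suc-last (suc K) (λ i → ℚC K i * h i) ⟩
  (∑[ i < suc K ] ℚC K i * h i) + ℚC K (suc K) * h (suc K)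
    ≡⟨ cong (λ c → (∑[ i < suc K ] ℚC K i * h i) + c * h (suc K)) (K<i⇒ℚC≡0 (ℕP.n<1+n K)) ⟩
  (∑[ i < suc K ] ℚC K i * h i) + 0ℚ * h (suc K)
    ≡⟨ cong ((∑[ i < suc K ] ℚC K i * h i) +_) (ℚP.*-zeroˡ (h (suc K))) ⟩
  (∑[ i < suc K ] ℚC K i * h i) + 0ℚ             ≡⟨ ℚP.+-identityʳ _ ⟩
  ∑[ i < suc K ] ℚC K i * h i                     ∎

∑-binomial-pascal : ∀ K (h : ℕ → ℚ) →
  ∑[ i < suc (suc K) ] ℚC (suc K) i * h i ≡ ∑[ i < suc K ] ℚC K i * (h i + h (suc i))
∑-binomial-pascal K h = begin
  h₀ + (∑[ i < suc K ] ℚC (suc K) (suc i) * h (suc i))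
    ≡⟨ cong (h₀ +_) (∑<-cong (suc K) (λ i → trans (cong (_* h (suc i)) (ℚC-pascal K i))
                                                  (ℚP.*-distribʳ-+ (h (suc i)) (ℚC K i) _))) ⟩
  h₀ + (∑[ i < suc K ] (ℚC K i * h (suc i) + ℚC K (suc i) * h (suc i)))
    ≡⟨ cong (h₀ +_) (∑<-+ (suc K) (λ i → ℚC K i * h (suc i)) (λ i → ℚC K (suc i) * h (suc i))) ⟩
  h₀ + (shifted + (∑[ i < suc K ] ℚC K (suc i) * h (suc i)))
    ≡⟨ +-CS.x∙yz≈y∙xz h₀ shifted _ ⟩
  shifted + (∑[ i < suc (suc K) ] ℚC K i * h i)
    ≡⟨ cong (shifted +_) (∑-binomial-extend K h) ⟩
  shifted + (∑[ i < suc K ] ℚC K i * h i)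
    ≡⟨ ℚP.+-comm shifted _ ⟩
  (∑[ i < suc K ] ℚC K i * h i) + shifted
    ≡⟨ ∑<-+ (suc K) (λ i → ℚC K i * h i) (λ i → ℚC K i * h (suc i)) ⟨
  ∑[ i < suc K ] (ℚC K i * h i + ℚC K i * h (suc i))
    ≡⟨ ∑<-cong (suc K) (λ i → ℚP.*-distribˡ-+ (ℚC K i) (h i) (h (suc i))) ⟨
  ∑[ i < suc K ] ℚC K i * (h i + h (suc i)) ∎
  where
  h₀ = ℚC (suc K) 0 * h 0
  shifted = ∑[ i < suc K ] ℚC K i * h (suc i)

∑-binomial-alternating : ∀ K S → ∑[ i < suc K ] ℚC K i * (sgn i * ℚC i S) ≡ sgn K * δ S K
∑-binomial-alternating zero    zero    = refl
∑-binomial-alternating zero    (suc S) = refl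
∑-binomial-alternating (suc K) zero    = begin
  ∑[ i < suc (suc K) ] ℚC (suc K) i * (sgn i * 1ℚ)
    ≡⟨ ∑-binomial-pascal K (λ i → sgn i * 1ℚ) ⟩
  ∑[ i < suc K ] ℚC K i * (sgn i * 1ℚ + (- sgn i) * 1ℚ)
    ≡⟨ ∑<-cong (suc K) (λ i → cong (ℚC K i *_) (solve 1 (λ x → x :* con 1ℚ :+ (:- x) :* con 1ℚ := con 0ℚ) refl (sgn i))) ⟩
  ∑[ i < suc K ] ℚC K i * 0ℚ
    ≡⟨ trans (∑<-cong (suc K) (λ i → ℚP.*-zeroʳ (ℚC K i))) (∑<-zero (suc K)) ⟩
  0ℚ
    ≡⟨ ℚP.*-zeroʳ (sgn (suc K)) ⟨
  sgn (suc K) * δ 0 (suc K) ∎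
∑-binomial-alternating (suc K) (suc S) = begin
  ∑[ i < suc (suc K) ] ℚC (suc K) i * (sgn i * ℚC i (suc S))
    ≡⟨ ∑-binomial-pascal K (λ i → sgn i * ℚC i (suc S)) ⟩
  ∑[ i < suc K ] ℚC K i * (sgn i * ℚC i (suc S) + (- sgn i) * ℚC (suc i) (suc S))
    ≡⟨ ∑<-cong (suc K) (λ i → cong (ℚC K i *_) (pascal-step i)) ⟩
  ∑[ i < suc K ] ℚC K i * (- (sgn i * ℚC i S))
    ≡⟨ ∑<-cong (suc K) (λ i → ℚP.neg-distribʳ-* (ℚC K i) (sgn i * ℚC i S)) ⟨
  ∑[ i < suc K ] (- (ℚC K i * (sgn i * ℚC i S)))
    ≡⟨ ∑<-neg (suc K) (λ i → ℚC K i * (sgn i * ℚC i S)) ⟩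
  - (∑[ i < suc K ] ℚC K i * (sgn i * ℚC i S))
    ≡⟨ cong -_ (∑-binomial-alternating K S) ⟩
  - (sgn K * δ S K)
    ≡⟨ ℚP.neg-distribˡ-* (sgn K) (δ S K) ⟩
  sgn (suc K) * δ (suc S) (suc K) ∎
  where
  pascal-step : ∀ i → sgn i * ℚC i (suc S) + (- sgn i) * ℚC (suc i) (suc S) ≡ - (sgn i * ℚC i S)
  pascal-step i = trans (cong (λ c → sgn i * ℚC i (suc S) + (- sgn i) * c) (ℚC-pascal i S))
    (solve 3 (λ a x y → a :* y :+ (:- a) :* (x :+ y) := :- (a :* x)) refl (sgn i) (ℚC i S) (ℚC i (suc S)))

binomial-inversionˡ : ∀ K S → ∑[ i < suc K ] (sgn (K ∸ i) * ℚC K i) * ℚC i S ≡ δ S K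
binomial-inversionˡ K S = begin
  ∑[ i < suc K ] (sgn (K ∸ i) * ℚC K i) * ℚC i S
    ≡⟨ ∑<-cong (suc K) (λ i → trans (cong (_* ℚC i S) (signed-binomial K i)) (regroup (sgn K) (sgn i) (ℚC K i) (ℚC i S))) ⟩
  ∑[ i < suc K ] sgn K * (ℚC K i * (sgn i * ℚC i S))
    ≡⟨ ∑<-*ˡ (suc K) (sgn K) (λ i → ℚC K i * (sgn i * ℚC i S)) ⟩
  sgn K * (∑[ i < suc K ] ℚC K i * (sgn i * ℚC i S))
    ≡⟨ cong (sgn K *_) (∑-binomial-alternating K S) ⟩
  sgn K * (sgn K * δ S K)
    ≡⟨ ℚP.*-assoc (sgn K) (sgn K) (δ S K) ⟨
  (sgn K * sgn K) * δ S K
    ≡⟨ trans (cong (_* δ S K) (sgn² K)) (ℚP.*-identityˡ (δ S K)) ⟩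
  δ S K ∎
  where
  regroup : ∀ s t c d → (s * (t * c)) * d ≡ s * (c * (t * d))
  regroup = solve 4 (λ s t c d → (s :* (t :* c)) :* d := s :* (c :* (t :* d))) refl

binomial-inversionʳ : ∀ K S → ∑[ i < suc K ] ℚC K i * (sgn (i ∸ S) * ℚC i S) ≡ δ S K
binomial-inversionʳ K S = begin
  ∑[ i < suc K ] ℚC K i * (sgn (i ∸ S) * ℚC i S)
    ≡⟨ ∑<-cong (suc K) (λ i → trans (cong (ℚC K i *_) (signed-binomial i S)) (regroup (ℚC K i) (sgn i) (sgn S) (ℚC i S))) ⟩
  ∑[ i < suc K ] sgn S * (ℚC K i * (sgn i * ℚC i S))
    ≡⟨ ∑<-*ˡ (suc K) (sgn S) (λ i → ℚC K i * (sgn i * ℚC i S)) ⟩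
  sgn S * (∑[ i < suc K ] ℚC K i * (sgn i * ℚC i S))
    ≡⟨ cong (sgn S *_) (trans (∑-binomial-alternating K S) (δ-transport sgn S K)) ⟩
  sgn S * (sgn S * δ S K)
    ≡⟨ ℚP.*-assoc (sgn S) (sgn S) (δ S K) ⟨
  (sgn S * sgn S) * δ S K
    ≡⟨ trans (cong (_* δ S K) (sgn² S)) (ℚP.*-identityˡ (δ S K)) ⟩
  δ S K ∎
  where
  regroup : ∀ c i s d → c * (i * (s * d)) ≡ s * (c * (i * d))
  regroup = solve 4 (λ c i s d → c :* (i :* (s :* d)) := s :* (c :* (i :* d))) refl

Letter : Set
Letter = ℕ → List (ℚ × ℕ)

binomialLetter signedLetter : ℕ → Letter
binomialLetter a k = map (λ r → (ℚC (k ∸ a) (r ∸ a) , r)) (range a k)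
signedLetter   a k = map (λ r → (sgn (k ∸ r) * ℚC (k ∸ a) (r ∸ a) , r)) (range a k)

record HasKernel (a : ℕ) (κ : ℕ → ℕ → ℚ) (L : Letter) : Set where
  constructor kernel
  field on-letter : ∀ K (F : ℕ → ℚ) → linℚ F (L (a ℕ.+ K)) ≡ ∑[ i < suc K ] κ K i * F (a ℕ.+ i)
open HasKernel

LowerTriangular : (ℕ → ℕ → ℚ) → Set
LowerTriangular κ = ∀ K i → K < i → κ K i ≡ 0ℚ

signedBinomial : ℕ → ℕ → ℚ
signedBinomial K i = sgn (K ∸ i) * ℚC K i

ℚC-lowerTriangular : LowerTriangular ℚC
ℚC-lowerTriangular K i = K<i⇒ℚC≡0

signedBinomial-lowerTriangular : LowerTriangular signedBinomial
signedBinomial-lowerTriangular K i K<i = trans (cong (sgn (K ∸ i) *_) (K<i⇒ℚC≡0 K<i)) (ℚP.*-zeroʳ (sgn (K ∸ i)))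

linℚ-range : ∀ (h F : ℕ → ℚ) a K →
  linℚ F (map (λ r → (h r , r)) (range a (a ℕ.+ K))) ≡ ∑[ i < suc K ] h (a ℕ.+ i) * F (a ℕ.+ i)
linℚ-range h F a K = trans (∑-map (λ p → proj₁ p * F (proj₂ p)) _ (range a (a ℕ.+ K))) (∑-range (λ r → h r * F r) a K)

binomialLetter-kernel : ∀ a → HasKernel a ℚC (binomialLetter a)
binomialLetter-kernel a = kernel λ K F → trans (linℚ-range _ F a K) (∑<-cong (suc K) (λ i →
  cong (_* F (a ℕ.+ i)) (cong₂ ℚC (ℕP.m+n∸m≡n a K) (ℕP.m+n∸m≡n a i))))

signedLetter-kernel : ∀ a → HasKernel a signedBinomial (signedLetter a)
signedLetter-kernel a = kernel λ K F → trans (linℚ-range _ F a K) (∑<-cong (suc K) (λ i →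
  cong (_* F (a ℕ.+ i)) (cong₂ _*_ (cong sgn (ℕP.[m+n]∸[m+o]≡n∸o a K i))
                                   (cong₂ ℚC (ℕP.m+n∸m≡n a K) (ℕP.m+n∸m≡n a i)))))

LeftInverseAt : Letter → Letter → ℕ → Set
LeftInverseAt f g k = ∀ s → linℚ (λ r → linℚ (δ s) (f r)) (g k) ≡ δ s k

kernel-coeff : ∀ {a κ L} → HasKernel a κ L → LowerTriangular κ →
  ∀ K {s} → a ≤ s → linℚ (δ s) (L (a ℕ.+ K)) ≡ κ K (s ∸ a)
kernel-coeff {a} {κ} {L} L-kernel κ-triangular K {s} a≤s = begin
  linℚ (δ s) (L (a ℕ.+ K))                ≡⟨ on-letter L-kernel K (δ s) ⟩
  ∑[ i < suc K ] κ K i * δ s (a ℕ.+ i)    ≡⟨ ∑<-cong (suc K) (λ i → cong (κ K i *_) (δ-shift i a≤s)) ⟩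
  ∑[ i < suc K ] κ K i * δ (s ∸ a) i      ≡⟨ ∑-δ (suc K) (κ K) (s ∸ a) (κ-triangular K (s ∸ a)) ⟩
  κ K (s ∸ a)                             ∎

kernel-coeff-below : ∀ {a κ L} → HasKernel a κ L → ∀ K {s} → s < a → linℚ (δ s) (L (a ℕ.+ K)) ≡ 0ℚ
kernel-coeff-below {a} {κ} {L} L-kernel K {s} s<a = begin
  linℚ (δ s) (L (a ℕ.+ K))               ≡⟨ on-letter L-kernel K (δ s) ⟩
  ∑[ i < suc K ] κ K i * δ s (a ℕ.+ i)   ≡⟨ ∑<-cong (suc K) (λ i → trans (cong (κ K i *_) (δ-below i s<a)) (ℚP.*-zeroʳ (κ K i))) ⟩
  ∑[ i < suc K ] 0ℚ                      ≡⟨ ∑<-zero (suc K) ⟩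
  0ℚ                                     ∎

kernel-inverse : ∀ {a κ κ′ f g} → HasKernel a κ g → HasKernel a κ′ f → LowerTriangular κ′ →
  (∀ K S → ∑[ i < suc K ] κ K i * κ′ i S ≡ δ S K) → ∀ K → LeftInverseAt f g (a ℕ.+ K)
kernel-inverse {a} {κ} {κ′} {f} {g} g-kernel f-kernel κ′-triangular κκ′≡id K s
  with ℕP.≤-<-connex a s
... | inj₁ a≤s = begin
  linℚ (λ r → linℚ (δ s) (f r)) (g (a ℕ.+ K))          ≡⟨ on-letter g-kernel K _ ⟩
  ∑[ i < suc K ] κ K i * linℚ (δ s) (f (a ℕ.+ i))      ≡⟨ ∑<-cong (suc K) (λ i → cong (κ K i *_) (kernel-coeff f-kernel κ′-triangular i a≤s)) ⟩
  ∑[ i < suc K ] κ K i * κ′ i (s ∸ a)                  ≡⟨ κκ′≡id K (s ∸ a) ⟩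
  δ (s ∸ a) K                                          ≡⟨ δ-shift K a≤s ⟨
  δ s (a ℕ.+ K)                                        ∎
... | inj₂ s<a = begin
  linℚ (λ r → linℚ (δ s) (f r)) (g (a ℕ.+ K))          ≡⟨ on-letter g-kernel K _ ⟩
  ∑[ i < suc K ] κ K i * linℚ (δ s) (f (a ℕ.+ i))      ≡⟨ ∑<-cong (suc K) (λ i → trans (cong (κ K i *_) (kernel-coeff-below f-kernel i s<a)) (ℚP.*-zeroʳ (κ K i))) ⟩
  ∑[ i < suc K ] 0ℚ                                    ≡⟨ ∑<-zero (suc K) ⟩
  0ℚ                                                   ≡⟨ δ-below K s<a ⟨
  δ s (a ℕ.+ K)                                        ∎

binomial∘signed≡id : ∀ a K → LeftInverseAt (binomialLetter a) (signedLetter a) (a ℕ.+ K)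
binomial∘signed≡id a = kernel-inverse (signedLetter-kernel a) (binomialLetter-kernel a) ℚC-lowerTriangular binomial-inversionˡ

signed∘binomial≡id : ∀ a K → LeftInverseAt (signedLetter a) (binomialLetter a) (a ℕ.+ K)
signed∘binomial≡id a = kernel-inverse (binomialLetter-kernel a) (signedLetter-kernel a) signedBinomial-lowerTriangular binomial-inversionʳ

linℚ-cart-∷-zero : ∀ (F : Word → ℚ) xs xss → (∀ r rs → F (r ∷ rs) ≡ 0ℚ) → linℚ F (cart (xs ∷ xss)) ≡ 0ℚ
linℚ-cart-∷-zero F xs xss F≡0 = trans (linℚ-cart-∷ F xs xss)
  (trans (linℚ-cong xs (λ r → trans (linℚ-cong (cart xss) (F≡0 r)) (linℚ-zero (cart xss)))) (linℚ-zero xs))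

linℚ-δʷ-[]-cart : ∀ xs xss → linℚ (δʷ []) (cart (xs ∷ xss)) ≡ 0ℚ
linℚ-δʷ-[]-cart xs xss = linℚ-cart-∷-zero (δʷ []) xs xss (λ r rs → refl)

linℚ-δʷ-∷-cart : ∀ s ss xs xss →
  linℚ (δʷ (s ∷ ss)) (cart (xs ∷ xss)) ≡ linℚ (δ s) xs * linℚ (δʷ ss) (cart xss)
linℚ-δʷ-∷-cart s ss xs xss = linℚ-cart-product (δʷ (s ∷ ss)) (δ s) (δʷ ss) xs xss (δʷ-∷ s ss)

expand∘expand-coeff : ∀ f g f′ g′ k ks → LeftInverseAt f f′ k →
  (∀ ss → linℚ (λ v → linℚ (δʷ ss) (cart (map g v))) (cart (map g′ ks)) ≡ δʷ ss ks) →
  ∀ w → linℚ (λ v → linℚ (δʷ w) (expand f g v)) (expand f′ g′ (k ∷ ks)) ≡ δʷ w (k ∷ ks)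
expand∘expand-coeff f g f′ g′ k ks ff′≡id rest≡id [] =
  linℚ-cart-∷-zero _ (f′ k) (map g′ ks) (λ r rs → linℚ-δʷ-[]-cart (f r) (map g rs))
expand∘expand-coeff f g f′ g′ k ks ff′≡id rest≡id (s ∷ ss) = begin
  linℚ (λ v → linℚ (δʷ (s ∷ ss)) (expand f g v)) (cart (f′ k ∷ map g′ ks))
    ≡⟨ linℚ-cart-product _ (λ r → linℚ (δ s) (f r)) (λ rs → linℚ (δʷ ss) (cart (map g rs))) (f′ k) (map g′ ks)
                          (λ r rs → linℚ-δʷ-∷-cart s ss (f r) (map g rs)) ⟩
  linℚ (λ r → linℚ (δ s) (f r)) (f′ k) * linℚ (λ v → linℚ (δʷ ss) (cart (map g v))) (cart (map g′ ks))
    ≡⟨ cong₂ _*_ (ff′≡id s) (rest≡id ss) ⟩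
  δ s k * δʷ ss ks
    ≡⟨ δʷ-∷ s ss k ks ⟨
  δʷ (s ∷ ss) (k ∷ ks) ∎

expand-diagonal : ∀ g v → cart (map g v) ≡ expand g g v
expand-diagonal g []      = refl
expand-diagonal g (_ ∷ _) = refl

cart-map-inverse : ∀ g g′ ks → All (LeftInverseAt g g′) ks →
  ∀ ss → linℚ (λ v → linℚ (δʷ ss) (cart (map g v))) (cart (map g′ ks)) ≡ δʷ ss ks
cart-map-inverse g g′ []       []                []       = refl
cart-map-inverse g g′ []       []                (s ∷ ss) = refl
cart-map-inverse g g′ (k ∷ ks) (gg′≡id ∷ gs≡id) ss =
  trans (linℚ-cong (cart (map g′ (k ∷ ks))) (λ v → cong (linℚ (δʷ ss)) (expand-diagonal g v)))
        (expand∘expand-coeff g g g′ g′ k ks gg′≡id (cart-map-inverse g g′ ks gs≡id) ss)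

expand-inverse : ∀ f g f′ g′ k ks → LeftInverseAt f f′ k → All (LeftInverseAt g g′) ks →
  lin (expand f g) (expand f′ g′ (k ∷ ks)) ≈C ((1ℚ , k ∷ ks) ∷ [])
expand-inverse f g f′ g′ k ks ff′≡id gg′≡id w = begin
  coeff (lin (expand f g) (expand f′ g′ (k ∷ ks))) w
    ≡⟨ coeff≡linℚ-δʷ (lin (expand f g) (expand f′ g′ (k ∷ ks))) w ⟩
  linℚ (δʷ w) (lin (expand f g) (expand f′ g′ (k ∷ ks)))
    ≡⟨ linℚ-lin (δʷ w) (expand f g) (expand f′ g′ (k ∷ ks)) ⟩
  linℚ (λ v → linℚ (δʷ w) (expand f g v)) (expand f′ g′ (k ∷ ks))
    ≡⟨ expand∘expand-coeff f g f′ g′ k ks ff′≡id (cart-map-inverse g g′ ks gg′≡id) w ⟩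
  δʷ w (k ∷ ks)
    ≡⟨ linℚ-singleton (δʷ w) (k ∷ ks) ⟨
  linℚ (δʷ w) ((1ℚ , k ∷ ks) ∷ [])
    ≡⟨ coeff≡linℚ-δʷ ((1ℚ , k ∷ ks) ∷ []) w ⟨
  coeff ((1ℚ , k ∷ ks) ∷ []) w ∎

cart-∈ : ∀ xss {a w} → (a , w) ∈ cart xss → Pointwise (λ xs r → ∃[ c ] (c , r) ∈ xs) xss w
cart-∈ []         (here refl) = []
cart-∈ (xs ∷ xss) a,w∈cart with find (∈-concatMap⁻ _ {xs = xs} a,w∈cart)
... | (c , r) , c,r∈xs , a,w∈map with ∈-map⁻ _ a,w∈map
...   | (b , rs) , b,rs∈cart , refl = (c , c,r∈xs) ∷ cart-∈ xss b,rs∈cart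

LettersFrom : ℕ → Letter → Set
LettersFrom a L = ∀ k {c r} → (c , r) ∈ L k → a ≤ r

range-∈ : ∀ {a k r} → r ∈ range a k → a ≤ r
range-∈ {a} r∈range with ∈-map⁻ (a ℕ.+_) r∈range
... | i , _ , refl = ℕP.m≤m+n a i

range-letter-≥ : ∀ (h : ℕ → ℚ) a k {c r} → (c , r) ∈ map (λ r → (h r , r)) (range a k) → a ≤ r
range-letter-≥ h a k c,r∈ with ∈-map⁻ (λ r → (h r , r)) c,r∈
... | _ , r∈range , refl = range-∈ r∈range

binomialLetter-≥ : ∀ a → LettersFrom a (binomialLetter a)
binomialLetter-≥ a k = range-letter-≥ (λ r → ℚC (k ∸ a) (r ∸ a)) a k

signedLetter-≥ : ∀ a → LettersFrom a (signedLetter a)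
signedLetter-≥ a k = range-letter-≥ (λ r → sgn (k ∸ r) * ℚC (k ∸ a) (r ∸ a)) a k

cart-map-≥ : ∀ {b g} → LettersFrom b g → ∀ ks {rs} →
  Pointwise (λ xs r → ∃[ c ] (c , r) ∈ xs) (map g ks) rs → All (b ≤_) rs
cart-map-≥ g≥b []       []                  = []
cart-map-≥ g≥b (k ∷ ks) ((_ , r∈gk) ∷ rest) = g≥b k r∈gk ∷ cart-map-≥ g≥b ks rest

expand-Conv : ∀ {f g} → LettersFrom 2 f → LettersFrom 1 g → ∀ w → AllWords Conv (expand f g w)
expand-Conv f≥2 g≥1 []       (here refl) = conv-[]
expand-Conv {f} {g} f≥2 g≥1 (k ∷ ks) a,w∈ with cart-∈ (f k ∷ map g ks) a,w∈
... | (_ , r∈fk) ∷ rest = conv-∷ (f≥2 k r∈fk) (cart-map-≥ g≥1 ks rest)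

expand-Adm : ∀ {f g} → LettersFrom 1 f → ∀ w → AllWords Adm (expand f g w)
expand-Adm f≥1 []       (here refl) = adm-[]
expand-Adm {f} {g} f≥1 (k ∷ ks) a,w∈ with cart-∈ (f k ∷ map g ks) a,w∈
... | (_ , r∈fk) ∷ _ = adm-∷ (f≥1 k r∈fk)

above-elim : ∀ (P : ℕ → Set) {a k} → a ≤ k → (∀ K → P (a ℕ.+ K)) → P k
above-elim P a≤k P-above = subst P (ℕP.m+[n∸m]≡n a≤k) (P-above _)

U∘U⁻¹≡id : ∀ w → Conv w → lin U (U⁻¹ w) ≈C ((1ℚ , w) ∷ [])
U∘U⁻¹≡id []       _                  _ = refl
U∘U⁻¹≡id (k ∷ ks) (conv-∷ 2≤k ks≥1) = expand-inverse U-first U-rest Ui-first Ui-rest k ks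
  (above-elim (LeftInverseAt U-first Ui-first) 2≤k (binomial∘signed≡id 2))
  (All.map (λ 1≤k → above-elim (LeftInverseAt U-rest Ui-rest) 1≤k (binomial∘signed≡id 1)) ks≥1)

U⁻¹∘U≡id : ∀ w → Conv w → lin U⁻¹ (U w) ≈C ((1ℚ , w) ∷ [])
U⁻¹∘U≡id []       _                  _ = refl
U⁻¹∘U≡id (k ∷ ks) (conv-∷ 2≤k ks≥1) = expand-inverse Ui-first Ui-rest U-first U-rest k ks
  (above-elim (LeftInverseAt Ui-first U-first) 2≤k (signed∘binomial≡id 2))
  (All.map (λ 1≤k → above-elim (LeftInverseAt Ui-rest U-rest) 1≤k (signed∘binomial≡id 1)) ks≥1)

V∘V⁻¹≡id : ∀ w → Adm w → lin V (V⁻¹ w) ≈C ((1ℚ , w) ∷ [])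
V∘V⁻¹≡id []       _           _ = refl
V∘V⁻¹≡id (k ∷ ks) (adm-∷ 1≤k) = expand-inverse V-first V-rest Vi-first Vi-rest k ks
  (above-elim (LeftInverseAt V-first Vi-first) 1≤k (binomial∘signed≡id 1))
  (All.universal (binomial∘signed≡id 0) ks)

V⁻¹∘V≡id : ∀ w → Adm w → lin V⁻¹ (V w) ≈C ((1ℚ , w) ∷ [])
V⁻¹∘V≡id []       _           _ = refl
V⁻¹∘V≡id (k ∷ ks) (adm-∷ 1≤k) = expand-inverse Vi-first Vi-rest V-first V-rest k ks
  (above-elim (LeftInverseAt Vi-first V-first) 1≤k (signed∘binomial≡id 1))
  (All.universal (signed∘binomial≡id 0) ks)

-- Formal power series

≈P-isEquivalence : IsEquivalence _≈P_
≈P-isEquivalence = record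
  { refl = λ _ → refl ; sym = λ f≈g N → sym (f≈g N) ; trans = λ f≈g g≈h N → trans (f≈g N) (g≈h N) }

_⊕_ : PS → PS → PS
(f ⊕ g) N = f N + g N

⊛-unfold : ∀ f g N → (f ⊛ g) N ≡ ∑[ i < suc N ] f i * g (N ∸ i)
⊛-unfold f g N = ∑-upTo (suc N) (λ i → f i * g (N ∸ i))

⊛-cong : ∀ {f f′ g g′} → f ≈P f′ → g ≈P g′ → (f ⊛ g) ≈P (f′ ⊛ g′)
⊛-cong f≈f′ g≈g′ N = ∑-cong (upTo (suc N)) (λ i → cong₂ _*_ (f≈f′ i) (g≈g′ (N ∸ i)))

⊛-congˡ : ∀ {f f′} h → f ≈P f′ → (f ⊛ h) ≈P (f′ ⊛ h)
⊛-congˡ h f≈f′ = ⊛-cong f≈f′ (λ _ → refl)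

⊛-congʳ : ∀ f {g g′} → g ≈P g′ → (f ⊛ g) ≈P (f ⊛ g′)
⊛-congʳ f g≈g′ = ⊛-cong {f} (λ _ → refl) g≈g′

⊛-comm : ∀ f g → (f ⊛ g) ≈P (g ⊛ f)
⊛-comm f g N = begin
  (f ⊛ g) N                                   ≡⟨ ⊛-unfold f g N ⟩
  ∑[ i < suc N ] f i * g (N ∸ i)              ≡⟨ ∑<-reverse N (λ i → f i * g (N ∸ i)) ⟩
  ∑[ i < suc N ] f (N ∸ i) * g (N ∸ (N ∸ i))  ≡⟨ ∑<-cong-< (suc N) (λ i i≤N →
      trans (cong (λ j → f (N ∸ i) * g j) (ℕP.m∸[m∸n]≡n (ℕP.≤-pred i≤N))) (ℚP.*-comm (f (N ∸ i)) (g i))) ⟩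
  ∑[ i < suc N ] g i * f (N ∸ i)              ≡⟨ ⊛-unfold g f N ⟨
  (g ⊛ f) N                                   ∎

⊛-assoc : ∀ f g h → ((f ⊛ g) ⊛ h) ≈P (f ⊛ (g ⊛ h))
⊛-assoc f g h N = begin
  ((f ⊛ g) ⊛ h) N
    ≡⟨ ⊛-unfold (f ⊛ g) h N ⟩
  ∑[ s < suc N ] (f ⊛ g) s * h (N ∸ s)
    ≡⟨ ∑<-cong (suc N) (λ s → trans (cong (_* h (N ∸ s)) (⊛-unfold f g s))
         (trans (sym (∑<-*ʳ (suc s) (h (N ∸ s)) (λ i → f i * g (s ∸ i))))
                (∑<-cong-< (suc s) (λ i i≤s → trans (ℚP.*-assoc (f i) (g (s ∸ i)) (h (N ∸ s)))
                   (cong (λ j → f i * (g (s ∸ i) * h j)) (sym (∸-∸ s i (ℕP.≤-pred i≤s)))))))) ⟩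
  ∑[ s < suc N ] ∑[ i < suc s ] f i * (g (s ∸ i) * h (N ∸ i ∸ (s ∸ i)))
    ≡⟨ ∑<-triangle N (λ i j → f i * (g j * h (N ∸ i ∸ j))) ⟨
  ∑[ i < suc N ] ∑[ j < suc (N ∸ i) ] f i * (g j * h (N ∸ i ∸ j))
    ≡⟨ ∑<-cong (suc N) (λ i → trans (∑<-*ˡ (suc (N ∸ i)) (f i) (λ j → g j * h (N ∸ i ∸ j)))
                                     (cong (f i *_) (sym (⊛-unfold g h (N ∸ i))))) ⟩
  ∑[ i < suc N ] f i * (g ⊛ h) (N ∸ i)
    ≡⟨ ⊛-unfold f (g ⊛ h) N ⟨
  (f ⊛ (g ⊛ h)) N ∎
  where
  ∸-∸ : ∀ s i → i ≤ s → N ∸ i ∸ (s ∸ i) ≡ N ∸ s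
  ∸-∸ s i i≤s = trans (ℕP.∸-+-assoc N i (s ∸ i)) (cong (N ∸_) (ℕP.m+[n∸m]≡n i≤s))

⊛-identityˡ : ∀ f → (oneP ⊛ f) ≈P f
⊛-identityˡ f N = begin
  (oneP ⊛ f) N                                     ≡⟨ ⊛-unfold oneP f N ⟩
  1ℚ * f N + (∑[ i < N ] 0ℚ * f (N ∸ suc i))       ≡⟨ cong₂ _+_ (ℚP.*-identityˡ (f N))
                                                        (trans (∑<-cong N (λ i → ℚP.*-zeroˡ (f (N ∸ suc i)))) (∑<-zero N)) ⟩
  f N + 0ℚ                                         ≡⟨ ℚP.+-identityʳ (f N) ⟩
  f N                                              ∎

⊛-identityʳ : ∀ f → (f ⊛ oneP) ≈P f
⊛-identityʳ f N = trans (⊛-comm f oneP N) (⊛-identityˡ f N)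

⊛-commutativeMonoid : CommutativeMonoid _ _
⊛-commutativeMonoid = record
  { Carrier = PS ; _≈_ = _≈P_ ; _∙_ = _⊛_ ; ε = oneP
  ; isCommutativeMonoid = record
    { isMonoid = record
      { isSemigroup = record
        { isMagma = record { isEquivalence = ≈P-isEquivalence ; ∙-cong = ⊛-cong }
        ; assoc = ⊛-assoc }
      ; identity = ⊛-identityˡ , ⊛-identityʳ }
    ; comm = ⊛-comm } }

module ⊛-CS = CommSemigroupProperties (CommutativeMonoid.commutativeSemigroup ⊛-commutativeMonoid)

⊛-distribʳ-⊕ : ∀ f g h → ((f ⊕ g) ⊛ h) ≈P ((f ⊛ h) ⊕ (g ⊛ h))
⊛-distribʳ-⊕ f g h N = trans (∑-cong (upTo (suc N)) (λ i → ℚP.*-distribʳ-+ (h (N ∸ i)) (f i) (g i)))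
                             (∑-+ (λ i → f i * h (N ∸ i)) (λ i → g i * h (N ∸ i)) (upTo (suc N)))

⊛-linearʳ : ∀ {A : Set} f (xs : List A) (c : A → ℚ) (T : A → PS) →
  (f ⊛ (λ N → ∑[ x ∈ xs ] c x * T x N)) ≈P (λ N → ∑[ x ∈ xs ] c x * (f ⊛ T x) N)
⊛-linearʳ f xs c T N = begin
  ∑[ i ∈ upTo (suc N) ] f i * (∑[ x ∈ xs ] c x * T x (N ∸ i))
    ≡⟨ ∑-cong (upTo (suc N)) (λ i → sym (∑-*ˡ (f i) (λ x → c x * T x (N ∸ i)) xs)) ⟩
  ∑[ i ∈ upTo (suc N) ] ∑[ x ∈ xs ] f i * (c x * T x (N ∸ i))
    ≡⟨ ∑-swap (λ i x → f i * (c x * T x (N ∸ i))) (upTo (suc N)) xs ⟩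
  ∑[ x ∈ xs ] ∑[ i ∈ upTo (suc N) ] f i * (c x * T x (N ∸ i))
    ≡⟨ ∑-cong xs (λ x → trans (∑-cong (upTo (suc N)) (λ i → *-CS.x∙yz≈y∙xz (f i) (c x) (T x (N ∸ i))))
                              (∑-*ˡ (c x) (λ i → f i * T x (N ∸ i)) (upTo (suc N)))) ⟩
  ∑[ x ∈ xs ] c x * (f ⊛ T x) N ∎

⊛-linearˡ : ∀ {A : Set} (xs : List A) (c : A → ℚ) (T : A → PS) g →
  ((λ N → ∑[ x ∈ xs ] c x * T x N) ⊛ g) ≈P (λ N → ∑[ x ∈ xs ] c x * (T x ⊛ g) N)
⊛-linearˡ xs c T g N = trans (⊛-comm (λ N → ∑[ x ∈ xs ] c x * T x N) g N) (trans (⊛-linearʳ g xs c T N)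
  (∑-cong xs (λ x → cong (c x *_) (⊛-comm g (T x) N))))

⊛-linear∑<ʳ : ∀ f n (c : ℕ → ℚ) (T : ℕ → PS) →
  (f ⊛ (λ N → ∑[ i < n ] c i * T i N)) ≈P (λ N → ∑[ i < n ] c i * (f ⊛ T i) N)
⊛-linear∑<ʳ f n c T N = begin
  (f ⊛ (λ N → ∑[ i < n ] c i * T i N)) N                  ≡⟨ ⊛-congʳ f (λ M → sym (∑-upTo n (λ i → c i * T i M))) N ⟩
  (f ⊛ (λ N → ∑[ i ∈ upTo n ] c i * T i N)) N             ≡⟨ ⊛-linearʳ f (upTo n) c T N ⟩
  ∑[ i ∈ upTo n ] c i * (f ⊛ T i) N                       ≡⟨ ∑-upTo n (λ i → c i * (f ⊛ T i) N) ⟩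
  ∑[ i < n ] c i * (f ⊛ T i) N                            ∎

qpow≡δ : ∀ a N → qpow a N ≡ δ a N
qpow≡δ a N = cong 𝟙 (isYes≡does (N ℕ.≟ a))

qpow-⊛-as-∑ : ∀ a f N → (qpow a ⊛ f) N ≡ ∑[ i < suc N ] f (N ∸ i) * δ a i
qpow-⊛-as-∑ a f N = trans (⊛-unfold (qpow a) f N)
  (∑<-cong (suc N) (λ i → trans (cong (_* f (N ∸ i)) (qpow≡δ a i)) (ℚP.*-comm (δ a i) (f (N ∸ i)))))

qpow-⊛-≤ : ∀ {a N} f → a ≤ N → (qpow a ⊛ f) N ≡ f (N ∸ a)
qpow-⊛-≤ {a} {N} f a≤N = trans (qpow-⊛-as-∑ a f N)
  (∑-δ (suc N) (λ i → f (N ∸ i)) a (λ N<a → ⊥-elim (ℕP.<⇒≱ N<a a≤N)))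

qpow-⊛-> : ∀ {a N} f → N < a → (qpow a ⊛ f) N ≡ 0ℚ
qpow-⊛-> {a} {N} f N<a = trans (qpow-⊛-as-∑ a f N) (∑-δ-beyond (suc N) (λ i → f (N ∸ i)) a N<a)

qpow-+ : ∀ a b → (qpow a ⊛ qpow b) ≈P qpow (a ℕ.+ b)
qpow-+ a b N with ℕP.≤-<-connex a N
... | inj₁ a≤N = begin
  (qpow a ⊛ qpow b) N         ≡⟨ qpow-⊛-≤ (qpow b) a≤N ⟩
  qpow b (N ∸ a)              ≡⟨ qpow≡δ b (N ∸ a) ⟩
  δ b (N ∸ a)                 ≡⟨ δ-+ a b (N ∸ a) ⟨
  δ (a ℕ.+ b) (a ℕ.+ (N ∸ a)) ≡⟨ cong (δ (a ℕ.+ b)) (ℕP.m+[n∸m]≡n a≤N) ⟩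
  δ (a ℕ.+ b) N               ≡⟨ qpow≡δ (a ℕ.+ b) N ⟨
  qpow (a ℕ.+ b) N            ∎
... | inj₂ N<a = begin
  (qpow a ⊛ qpow b) N         ≡⟨ qpow-⊛-> (qpow b) N<a ⟩
  0ℚ                          ≡⟨ δ-< (ℕP.<-≤-trans N<a (ℕP.m≤m+n a b)) ⟨
  δ (a ℕ.+ b) N               ≡⟨ qpow≡δ (a ℕ.+ b) N ⟨
  qpow (a ℕ.+ b) N            ∎

qpow-zero : qpow 0 ≈P oneP
qpow-zero zero    = refl
qpow-zero (suc N) = refl

geom-unfold : ∀ {m} → 1 ≤ m → geom m ≈P (oneP ⊕ (qpow m ⊛ geom m))
geom-unfold {m} 1≤m zero = begin
  geom m 0                             ≡⟨ 𝟙-yes (m ∣0) (m ∣? 0) ⟩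
  1ℚ                                   ≡⟨ ℚP.+-identityʳ 1ℚ ⟨
  1ℚ + 0ℚ                              ≡⟨ cong (1ℚ +_) (qpow-⊛-> (geom m) 1≤m) ⟨
  oneP 0 + (qpow m ⊛ geom m) 0         ∎
geom-unfold {m} 1≤m (suc N) with ℕP.≤-<-connex m (suc N)
... | inj₁ m≤N = begin
  geom m (suc N)                       ≡⟨ 𝟙-⇔ (∣-∸ m≤N) (∣-∸⁻ m≤N) (m ∣? suc N) (m ∣? (suc N ∸ m)) ⟩
  geom m (suc N ∸ m)                   ≡⟨ qpow-⊛-≤ (geom m) m≤N ⟨
  (qpow m ⊛ geom m) (suc N)            ≡⟨ ℚP.+-identityˡ _ ⟨
  oneP (suc N) + (qpow m ⊛ geom m) (suc N) ∎
  where
  ∣-∸ : ∀ {n} → m ≤ n → m ∣ n → m ∣ n ∸ m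
  ∣-∸ m≤n m∣n = ∣m+n∣m⇒∣n (subst (m ∣_) (sym (ℕP.m+[n∸m]≡n m≤n)) m∣n) ∣-refl
  ∣-∸⁻ : ∀ {n} → m ≤ n → m ∣ n ∸ m → m ∣ n
  ∣-∸⁻ m≤n m∣n∸m = subst (m ∣_) (ℕP.m+[n∸m]≡n m≤n) (∣m∣n⇒∣m+n ∣-refl m∣n∸m)
... | inj₂ N<m = begin
  geom m (suc N)                       ≡⟨ 𝟙-no (λ m∣N → ℕP.<⇒≱ N<m (∣⇒≤ m∣N)) (m ∣? suc N) ⟩
  0ℚ                                   ≡⟨ ℚP.+-identityˡ 0ℚ ⟨
  0ℚ + 0ℚ                              ≡⟨ cong (0ℚ +_) (qpow-⊛-> (geom m) N<m) ⟨
  oneP (suc N) + (qpow m ⊛ geom m) (suc N) ∎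

-- The letter identities of q-series

linPS : {A : Set} → (A → PS) → List (ℚ × A) → PS
linPS F c N = linℚ (λ v → F v N) c

szFactor bzFactor : ℕ → ℕ → PS
szFactor k m = qpow (m ℕ.* k) ⊛ (geom m ^P k)
bzFactor k m = qpow ((k ∸ 1) ℕ.* m) ⊛ (geom m ^P k)

module LetterSeries {m : ℕ} (1≤m : 1 ≤ m) where

  g x : PS
  g = geom m
  x = qpow m

  -- T i = (q^m g)^i, and g = 1 + q^m g turns Σᵢ C(K,i) T i into (1 + q^m g)^K = g^K.
  T : ℕ → PS
  T i = qpow (m ℕ.* i) ⊛ (g ^P i)

  T-suc : ∀ i → T (suc i) ≈P ((x ⊛ g) ⊛ T i)
  T-suc i N = begin
    (qpow (m ℕ.* suc i) ⊛ (g ⊛ (g ^P i))) N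
      ≡⟨ ⊛-congˡ (g ⊛ (g ^P i)) (λ M → trans (cong (λ e → qpow e M) (ℕP.*-suc m i)) (sym (qpow-+ m (m ℕ.* i) M))) N ⟩
    ((x ⊛ qpow (m ℕ.* i)) ⊛ (g ⊛ (g ^P i))) N
      ≡⟨ ⊛-CS.interchange x (qpow (m ℕ.* i)) g (g ^P i) N ⟩
    ((x ⊛ g) ⊛ T i) N ∎

  binomial-theorem : ∀ K → (λ N → ∑[ i < suc K ] ℚC K i * T i N) ≈P (g ^P K)
  ∑-binomial-factor : ∀ K P (F : ℕ → PS) → (∀ i → F i ≈P (P ⊛ T i)) →
    (λ N → ∑[ i < suc K ] ℚC K i * F i N) ≈P (P ⊛ (g ^P K))

  binomial-theorem zero N = begin
    1ℚ * T 0 N + 0ℚ            ≡⟨ linℚ-singleton (λ i → T i N) 0 ⟩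
    (qpow (m ℕ.* 0) ⊛ oneP) N  ≡⟨ ⊛-identityʳ (qpow (m ℕ.* 0)) N ⟩
    qpow (m ℕ.* 0) N           ≡⟨ cong (λ e → qpow e N) (ℕP.*-zeroʳ m) ⟩
    qpow 0 N                   ≡⟨ qpow-zero N ⟩
    oneP N                     ∎
  binomial-theorem (suc K) N = begin
    ∑[ i < suc (suc K) ] ℚC (suc K) i * T i N
      ≡⟨ ∑-binomial-pascal K (λ i → T i N) ⟩
    ∑[ i < suc K ] ℚC K i * (T i N + T (suc i) N)
      ≡⟨ ∑<-cong (suc K) (λ i → ℚP.*-distribˡ-+ (ℚC K i) (T i N) (T (suc i) N)) ⟩
    ∑[ i < suc K ] (ℚC K i * T i N + ℚC K i * T (suc i) N)
      ≡⟨ ∑<-+ (suc K) (λ i → ℚC K i * T i N) (λ i → ℚC K i * T (suc i) N) ⟩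
    (∑[ i < suc K ] ℚC K i * T i N) + (∑[ i < suc K ] ℚC K i * T (suc i) N)
      ≡⟨ cong₂ _+_ (binomial-theorem K N) (∑-binomial-factor K (x ⊛ g) (T ∘ suc) T-suc N) ⟩
    (g ^P K) N + ((x ⊛ g) ⊛ (g ^P K)) N
      ≡⟨ cong (_+ ((x ⊛ g) ⊛ (g ^P K)) N) (⊛-identityˡ (g ^P K) N) ⟨
    (oneP ⊛ (g ^P K)) N + ((x ⊛ g) ⊛ (g ^P K)) N
      ≡⟨ ⊛-distribʳ-⊕ oneP (x ⊛ g) (g ^P K) N ⟨
    ((oneP ⊕ (x ⊛ g)) ⊛ (g ^P K)) N
      ≡⟨ ⊛-congˡ (g ^P K) (geom-unfold 1≤m) N ⟨
    (g ^P suc K) N ∎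

  ∑-binomial-factor K P F F≈P⊛T N = begin
    ∑[ i < suc K ] ℚC K i * F i N          ≡⟨ ∑<-cong (suc K) (λ i → cong (ℚC K i *_) (F≈P⊛T i N)) ⟩
    ∑[ i < suc K ] ℚC K i * (P ⊛ T i) N    ≡⟨ ⊛-linear∑<ʳ P (suc K) (ℚC K) T N ⟨
    (P ⊛ (λ N → ∑[ i < suc K ] ℚC K i * T i N)) N ≡⟨ ⊛-congʳ P (binomial-theorem K) N ⟩
    (P ⊛ (g ^P K)) N                       ∎

  on-binomialLetter : ∀ a K (f : ℕ → ℕ → PS) →
    linPS (λ r → f r m) (binomialLetter a (a ℕ.+ K)) ≈P (λ N → ∑[ i < suc K ] ℚC K i * f (a ℕ.+ i) m N)
  on-binomialLetter a K f N = on-letter (binomialLetter-kernel a) K (λ r → f r m N)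

  V-rest-series : ∀ K → linPS (λ r → szFactor r m) (binomialLetter 0 K) ≈P (g ^P K)
  V-rest-series K N = trans (on-binomialLetter 0 K szFactor N) (binomial-theorem K N)

  V-first-series : ∀ K → linPS (λ r → szFactor r m) (binomialLetter 1 (suc K)) ≈P (x ⊛ (g ^P suc K))
  V-first-series K N = begin
    linPS (λ r → szFactor r m) (binomialLetter 1 (suc K)) N ≡⟨ on-binomialLetter 1 K szFactor N ⟩
    ∑[ i < suc K ] ℚC K i * T (suc i) N                     ≡⟨ ∑-binomial-factor K (x ⊛ g) (T ∘ suc) T-suc N ⟩
    ((x ⊛ g) ⊛ (g ^P K)) N                                  ≡⟨ ⊛-assoc x g (g ^P K) N ⟩
    (x ⊛ (g ^P suc K)) N                                    ∎

  U-rest-series : ∀ K → linPS (λ r → bzFactor r m) (binomialLetter 1 (suc K)) ≈P (g ^P suc K)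
  U-rest-series K N = trans (on-binomialLetter 1 K bzFactor N) (∑-binomial-factor K g (λ i → bzFactor (suc i) m) factor N)
    where
    factor : ∀ i → bzFactor (suc i) m ≈P (g ⊛ T i)
    factor i N = begin
      (qpow (i ℕ.* m) ⊛ (g ⊛ (g ^P i))) N  ≡⟨ cong (λ e → (qpow e ⊛ (g ⊛ (g ^P i))) N) (ℕP.*-comm i m) ⟩
      (qpow (m ℕ.* i) ⊛ (g ⊛ (g ^P i))) N  ≡⟨ ⊛-CS.x∙yz≈y∙xz (qpow (m ℕ.* i)) g (g ^P i) N ⟩
      (g ⊛ T i) N                          ∎

  U-first-series : ∀ K → linPS (λ r → bzFactor r m) (binomialLetter 2 (2 ℕ.+ K)) ≈P (x ⊛ (g ^P (2 ℕ.+ K)))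
  U-first-series K N = begin
    linPS (λ r → bzFactor r m) (binomialLetter 2 (2 ℕ.+ K)) N
      ≡⟨ on-binomialLetter 2 K bzFactor N ⟩
    ∑[ i < suc K ] ℚC K i * bzFactor (2 ℕ.+ i) m N
      ≡⟨ ∑-binomial-factor K (x ⊛ (g ⊛ g)) (λ i → bzFactor (2 ℕ.+ i) m) factor N ⟩
    ((x ⊛ (g ⊛ g)) ⊛ (g ^P K)) N
      ≡⟨ ⊛-assoc x (g ⊛ g) (g ^P K) N ⟩
    (x ⊛ ((g ⊛ g) ⊛ (g ^P K))) N
      ≡⟨ ⊛-congʳ x (⊛-assoc g g (g ^P K)) N ⟩
    (x ⊛ (g ^P (2 ℕ.+ K))) N ∎
    where
    factor : ∀ i → bzFactor (2 ℕ.+ i) m ≈P ((x ⊛ (g ⊛ g)) ⊛ T i)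
    factor i N = begin
      (qpow (m ℕ.+ i ℕ.* m) ⊛ (g ⊛ (g ⊛ (g ^P i)))) N
        ≡⟨ ⊛-cong (λ M → trans (cong (λ e → qpow (m ℕ.+ e) M) (ℕP.*-comm i m)) (sym (qpow-+ m (m ℕ.* i) M)))
                  (λ M → sym (⊛-assoc g g (g ^P i) M)) N ⟩
      ((x ⊛ qpow (m ℕ.* i)) ⊛ ((g ⊛ g) ⊛ (g ^P i))) N
        ≡⟨ ⊛-CS.interchange x (qpow (m ℕ.* i)) (g ⊛ g) (g ^P i) N ⟩
      ((x ⊛ (g ⊛ g)) ⊛ T i) N ∎

-- Products over the letters of a word

linPS-cart-product : ∀ (F : Word → PS) (A : ℕ → PS) (B : Word → PS) xs xss →
  (∀ r rs → F (r ∷ rs) ≈P (A r ⊛ B rs)) → linPS F (cart (xs ∷ xss)) ≈P (linPS A xs ⊛ linPS B (cart xss))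
linPS-cart-product F A B xs xss F≈A⊛B N = begin
  linPS F (cart (xs ∷ xss)) N
    ≡⟨ linℚ-cart-∷ (λ v → F v N) xs xss ⟩
  linℚ (λ r → linℚ (λ rs → F (r ∷ rs) N) (cart xss)) xs
    ≡⟨ linℚ-cong xs (λ r → linℚ-cong (cart xss) (λ rs → F≈A⊛B r rs N)) ⟩
  linℚ (λ r → linℚ (λ rs → (A r ⊛ B rs) N) (cart xss)) xs
    ≡⟨ linℚ-cong xs (λ r → ⊛-linearʳ (A r) (cart xss) proj₁ (B ∘ proj₂) N) ⟨
  linℚ (λ r → (A r ⊛ linPS B (cart xss)) N) xs
    ≡⟨ ⊛-linearˡ xs proj₁ (A ∘ proj₂) (linPS B (cart xss)) N ⟨
  (linPS A xs ⊛ linPS B (cart xss)) N ∎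

len≡length : ∀ w → len w ≡ length w
len≡length []      = refl
len≡length (_ ∷ w) = cong suc (len≡length w)

decSeqs-∈ : ∀ n M {ms} → ms ∈ decSeqs n M → len ms ≡ n × All (1 ≤_) ms
decSeqs-∈ zero    M (here refl) = refl , []
decSeqs-∈ (suc n) M ms∈ with find (∈-concatMap⁻ _ {xs = range 1 M} ms∈)
... | m , m∈range , ms∈map with ∈-map⁻ (m ∷_) ms∈map
...   | ms′ , ms′∈ , refl with decSeqs-∈ n (m ∸ 1) ms′∈
...     | len≡n , ms′≥1 = cong suc len≡n , range-∈ m∈range ∷ ms′≥1

oozFactor : ℕ → ℕ → PS
oozFactor k m = geom m ^P k

RestSeries : (ℕ → ℕ → PS) → Letter → ℕ → Set
RestSeries f G k = ∀ m → 1 ≤ m → linPS (λ r → f r m) (G k) ≈P (geom m ^P k)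

cart-map-series : ∀ f G ks ms → All (RestSeries f G) ks → All (1 ≤_) ms → len ms ≡ len ks →
  linPS (λ v → prodP (zipWith' f v ms)) (cart (map G ks)) ≈P prodP (zipWith' oozFactor ks ms)
cart-map-series f G []       []       []         []             _   N = linℚ-singleton (λ v → prodP (zipWith' f v []) N) []
cart-map-series f G (k ∷ ks) (m ∷ ms) (Gk ∷ Gks) (1≤m ∷ ms≥1) len≡ N = begin
  linPS (λ v → prodP (zipWith' f v (m ∷ ms))) (cart (G k ∷ map G ks)) N
    ≡⟨ linPS-cart-product (λ v → prodP (zipWith' f v (m ∷ ms))) (λ r → f r m) (λ rs → prodP (zipWith' f rs ms)) (G k) (map G ks) (λ r rs N → refl) N ⟩
  (linPS (λ r → f r m) (G k) ⊛ linPS (λ rs → prodP (zipWith' f rs ms)) (cart (map G ks))) N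
    ≡⟨ ⊛-cong (Gk m 1≤m) (cart-map-series f G ks ms Gks ms≥1 (ℕP.suc-injective len≡)) N ⟩
  prodP (zipWith' oozFactor (k ∷ ks) (m ∷ ms)) N ∎

FirstSeries : (ℕ → ℕ → PS) → List (ℚ × ℕ) → ℕ → Set
FirstSeries f first k = ∀ m → 1 ≤ m → linPS (λ r → f r m) first ≈P (qpow m ⊛ (geom m ^P k))

cart-series : ∀ f first G k ks m ms → FirstSeries f first k → All (RestSeries f G) ks →
  All (1 ≤_) (m ∷ ms) → len ms ≡ len ks →
  linPS (λ v → prodP (zipWith' f v (m ∷ ms))) (cart (first ∷ map G ks)) ≈P (qpow m ⊛ prodP (zipWith' oozFactor (k ∷ ks) (m ∷ ms)))
cart-series f first G k ks m ms first≈ rest≈ (1≤m ∷ ms≥1) len≡ N = begin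
  linPS (λ v → prodP (zipWith' f v (m ∷ ms))) (cart (first ∷ map G ks)) N
    ≡⟨ linPS-cart-product (λ v → prodP (zipWith' f v (m ∷ ms))) (λ r → f r m) (λ rs → prodP (zipWith' f rs ms)) first (map G ks) (λ r rs N → refl) N ⟩
  (linPS (λ r → f r m) first ⊛ linPS (λ rs → prodP (zipWith' f rs ms)) (cart (map G ks))) N
    ≡⟨ ⊛-cong (first≈ m 1≤m) (cart-map-series f G ks ms rest≈ ms≥1 len≡) N ⟩
  ((qpow m ⊛ (geom m ^P k)) ⊛ prodP (zipWith' oozFactor ks ms)) N
    ≡⟨ ⊛-assoc (qpow m) (geom m ^P k) (prodP (zipWith' oozFactor ks ms)) N ⟩
  (qpow m ⊛ prodP (zipWith' oozFactor (k ∷ ks) (m ∷ ms))) N ∎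

cart-∈-len : ∀ xss {a w} → (a , w) ∈ cart xss → len w ≡ length xss
cart-∈-len xss {w = w} a,w∈ = trans (len≡length w) (sym (Pointwise-length (cart-∈ xss a,w∈)))

ζOOZ-via-letters : ∀ (ζ : Word → PS) (f : ℕ → ℕ → PS) →
  (∀ r rs N → ζ (r ∷ rs) N ≡ ∑[ ms ∈ decSeqs (len (r ∷ rs)) N ] prodP (zipWith' f (r ∷ rs) ms) N) →
  ∀ first G k ks → FirstSeries f first k → All (RestSeries f G) ks →
  ζOOZ (k ∷ ks) ≈P linζ ζ (cart (first ∷ map G ks))
ζOOZ-via-letters ζ f ζ-unfold first G k ks first≈ rest≈ N = begin
  ζOOZ (k ∷ ks) N
    ≡⟨ trans (∑-map (λ p → p N) _ tuples) (∑-cong-∈ tuples λ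
         { {[]}     ms∈ → ⊥-elim (ℕP.0≢1+n (proj₁ (decSeqs-∈ (suc (len ks)) N ms∈)))
         ; {m ∷ ms} ms∈ → let len≡ , ms≥1 = decSeqs-∈ (suc (len ks)) N ms∈ in
             sym (cart-series f first G k ks m ms first≈ rest≈ ms≥1 (ℕP.suc-injective len≡) N) }) ⟩
  ∑[ ms ∈ tuples ] linℚ (λ v → prodP (zipWith' f v ms) N) (cart yss)
    ≡⟨ linℚ-∑ (λ v ms → prodP (zipWith' f v ms) N) tuples (cart yss) ⟨
  linℚ (λ v → ∑[ ms ∈ tuples ] prodP (zipWith' f v ms) N) (cart yss)
    ≡⟨ linℚ-cong-∈ (cart yss) (λ
         { {v = []}     v∈ → ⊥-elim (ℕP.0≢1+n (cart-∈-len yss v∈))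
         ; {v = r ∷ rs} v∈ → trans (cong (λ n → ∑[ ms ∈ decSeqs n N ] prodP (zipWith' f (r ∷ rs) ms) N)
                                        (sym (trans (cart-∈-len yss v∈) length-yss)))
                                  (sym (ζ-unfold r rs N)) }) ⟩
  linℚ (λ v → ζ v N) (cart yss)
    ≡⟨⟩
  linζ ζ (cart yss) N ∎
  where
  yss = first ∷ map G ks
  tuples = decSeqs (suc (len ks)) N
  length-yss : length yss ≡ suc (len ks)
  length-yss = cong suc (trans (length-map G ks) (sym (len≡length ks)))

ζBZ-unfold : ∀ r rs N → ζBZ (r ∷ rs) N ≡ ∑[ ms ∈ decSeqs (len (r ∷ rs)) N ] prodP (zipWith' bzFactor (r ∷ rs) ms) N
ζBZ-unfold r rs N = ∑-map (λ p → p N) _ (decSeqs (len (r ∷ rs)) N)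

ζSZ-unfold : ∀ r rs N → ζSZ (r ∷ rs) N ≡ ∑[ ms ∈ decSeqs (len (r ∷ rs)) N ] prodP (zipWith' szFactor (r ∷ rs) ms) N
ζSZ-unfold r rs N = ∑-map (λ p → p N) _ (decSeqs (len (r ∷ rs)) N)

ζOOZ≈ζBZ∘U : ∀ w → Conv w → ζOOZ w ≈P linζ ζBZ (U w)
ζOOZ≈ζBZ∘U []       _                  N = sym (linℚ-singleton (λ v → ζBZ v N) [])
ζOOZ≈ζBZ∘U (k ∷ ks) (conv-∷ 2≤k ks≥1) =
  above-elim (λ k → ζOOZ (k ∷ ks) ≈P linζ ζBZ (U (k ∷ ks))) 2≤k λ K →
    ζOOZ-via-letters ζBZ bzFactor ζBZ-unfold (U-first (2 ℕ.+ K)) U-rest (2 ℕ.+ K) ks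
      (λ m 1≤m → LetterSeries.U-first-series 1≤m K)
      (All.map (λ 1≤k → above-elim (RestSeries bzFactor U-rest) 1≤k (λ K m 1≤m → LetterSeries.U-rest-series 1≤m K)) ks≥1)

ζOOZ≈ζSZ∘V : ∀ w → Adm w → ζOOZ w ≈P linζ ζSZ (V w)
ζOOZ≈ζSZ∘V []       _           N = sym (linℚ-singleton (λ v → ζSZ v N) [])
ζOOZ≈ζSZ∘V (k ∷ ks) (adm-∷ 1≤k) =
  above-elim (λ k → ζOOZ (k ∷ ks) ≈P linζ ζSZ (V (k ∷ ks))) 1≤k λ K →
    ζOOZ-via-letters ζSZ szFactor ζSZ-unfold (V-first (suc K)) V-rest (suc K) ks
      (λ m 1≤m → LetterSeries.V-first-series 1≤m K)
      (All.universal (λ k m 1≤m → LetterSeries.V-rest-series 1≤m k) ks)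

proposition5p7 :
    ((w : Word) → Conv w →
        AllWords Conv (U w) × AllWords Conv (U⁻¹ w)
      × lin U (U⁻¹ w) ≈C ((1ℚ , w) ∷ []) × lin U⁻¹ (U w) ≈C ((1ℚ , w) ∷ []))
    × ((w : Word) → Adm w →
        AllWords Adm (V w) × AllWords Adm (V⁻¹ w)
      × lin V (V⁻¹ w) ≈C ((1ℚ , w) ∷ []) × lin V⁻¹ (V w) ≈C ((1ℚ , w) ∷ []))
    × ((w : Word) → Conv w → ζOOZ w ≈P linζ ζBZ (U w))
    × ((w : Word) → Adm w → ζOOZ w ≈P linζ ζSZ (V w))
proposition5p7 =
    (λ w conv → expand-Conv (binomialLetter-≥ 2) (binomialLetter-≥ 1) w
              , expand-Conv (signedLetter-≥ 2) (signedLetter-≥ 1) w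
              , U∘U⁻¹≡id w conv , U⁻¹∘U≡id w conv)
  , (λ w adm → expand-Adm (binomialLetter-≥ 1) w
             , expand-Adm (signedLetter-≥ 1) w
             , V∘V⁻¹≡id w adm , V⁻¹∘V≡id w adm)
  , ζOOZ≈ζBZ∘U
  , ζOOZ≈ζSZ∘V
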